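{- Let $r\ge 1$ be an integer. For $n\ge 0$ let $\mathcal{Q}_n^{(r)}$ be the set of all permutations $a_1a_2\cdots a_{nr}$ of the multiset $\{1^r,2^r,\dots,n^r\}$ (each of $1,\dots,n$ appearing exactly $r$ times) such that whenever $i<j<k$ and $a_i=a_k$, we have $a_j\ge a_i$; for $n=0$ this set consists of the empty permutation only. For a sequence $\pi=a_1\cdots a_m$ of integers, let $d(\pi)$ be the number of indices $i<m$ with $a_i>a_{i+1}$, plus $1$ if $\pi$ is nonempty (so $d(\varnothing)=0$). Define \[A_n^{(r)}(t)=\sum_{\pi\in\mathcal{Q}_n^{(r)}} t^{d(\pi)},\qquad A^{(r)}=A^{(r)}(z,t)=\sum_{n\ge 0}A_n^{(r)}(t)\frac{z^n}{n!}.\] Then, as formal power series in $z$ with coefficients in $\mathbb{Q}[t]$, \[\frac{d}{dz}A^{(r)}=\bigl[A^{(r)}\bigr]^r\bigl[A^{(r)}-1\bigr]+t\bigl[A^{(r)}\bigr]^r.\]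
   Context: Elements of $\mathcal{Q}_n^{(r)}$ are called $r$-permutations; for $r=1$ they are ordinary permutations and $A_n^{(1)}(t)$ is the Eulerian polynomial (with the convention that a descent is also counted at the end of every nonempty sequence). -}

module Defs where

open import Data.Bool using (Bool; true; false; _∧_; if_then_else_)
open import Data.Nat using (ℕ; zero; suc; _∸_; _<ᵇ_; _≡ᵇ_; _!)
import Data.Nat as ℕ
open import Data.Nat.Properties using (_!≢0)
open import Data.Fin using (Fin; toℕ)
open import Data.Vec using (Vec; []; _∷_; lookup; toList; allFin)
import Data.Vec as Vec
open import Data.List using (List; []; _∷_; map; concatMap; upTo; filter; length; foldr)
open import Data.Integer using (+_)
open import Data.Rational using (ℚ; _+_; _*_; _-_; 0ℚ; 1ℚ; _/_)
open import Data.Bool using (T?)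

all : {A : Set} → (A → Bool) → List A → Bool
all p = foldr (λ x acc → p x ∧ acc) true

values : ℕ → List ℕ
values n = map suc (upTo n)

words : ℕ → (m : ℕ) → List (Vec ℕ m)
words n zero    = [] ∷ []
words n (suc m) = concatMap (λ w → map (λ a → a ∷ w) (values n)) (words n m)

count : ∀ {m} → ℕ → Vec ℕ m → ℕ
count a w = length (filter (λ x → x ℕ.≟ a) (toList w))

hasMultiplicities : ∀ {m} → ℕ → ℕ → Vec ℕ m → Bool
hasMultiplicities n r w = all (λ a → count a w ≡ᵇ r) (values n)

_≤ᵇ'_ : ℕ → ℕ → Bool
x ≤ᵇ' y = x <ᵇ suc y

_⇒ᵇ_ : Bool → Bool → Bool
true  ⇒ᵇ b = b
false ⇒ᵇ b = true

avoidsPattern : ∀ {m} → Vec ℕ m → Bool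
avoidsPattern {m} w =
  all (λ i → all (λ j → all (λ k →
        ((toℕ i <ᵇ toℕ j) ∧ (toℕ j <ᵇ toℕ k) ∧ (lookup w i ≡ᵇ lookup w k))
          ⇒ᵇ (lookup w i ≤ᵇ' lookup w j))
      (Vec.toList (allFin m))) (Vec.toList (allFin m))) (Vec.toList (allFin m))

Q : (n r : ℕ) → List (Vec ℕ (n ℕ.* r))
Q n r = filter (λ w → T? (hasMultiplicities n r w ∧ avoidsPattern w)) (words n (n ℕ.* r))

des : List ℕ → ℕ
des []           = 0
des (x ∷ [])     = 1
des (x ∷ y ∷ w)  = (if y <ᵇ x then 1 else 0) ℕ.+ des (y ∷ w)

d : ∀ {m} → Vec ℕ m → ℕ
d w = des (toList w)

-- number of π ∈ 𝒬ₙ⁽ʳ⁾ with d(π) = k, i.e. coefficient of t^k in Aₙ⁽ʳ⁾(t)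
coeffA : (r n k : ℕ) → ℕ
coeffA r n k = length (filter (λ w → T? (d w ≡ᵇ k)) (Q n r))

-- Formal power series in z, t over ℚ:  F = Σ_{n,k} F n k · z^n t^k

Series : Set
Series = ℕ → ℕ → ℚ

sumTo : ℕ → (ℕ → ℚ) → ℚ
sumTo n f = foldr (λ i acc → f i + acc) 0ℚ (upTo (suc n))

_⊕_ : Series → Series → Series
(f ⊕ g) n k = f n k + g n k

_⊖_ : Series → Series → Series
(f ⊖ g) n k = f n k - g n k

_⊛_ : Series → Series → Series
(f ⊛ g) n k = sumTo n (λ i → sumTo k (λ l → f i l * g (n ∸ i) (k ∸ l)))

oneS : Series
oneS zero zero = 1ℚ
oneS _    _    = 0ℚ

_^S_ : Series → ℕ → Series
f ^S zero  = oneS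
f ^S suc m = f ⊛ (f ^S m)

-- multiplication by t
tS : Series → Series
tS f n zero    = 0ℚ
tS f n (suc k) = f n k

∂z : Series → Series
∂z f n k = (+ suc n / 1) * f (suc n) k

A : ℕ → Series
A r n k = (+ coeffA r n k / (n !)) {{n !≢0}}

module Submission where

-- Let a(n, k) be the number of r-permutations of {1ʳ, …, nʳ} with k descents. Every r-permutation of
-- {1ʳ, …, (n+1)ʳ} arises in exactly one way by inserting the block of r letters n + 1 into one of the
-- n r + 1 gaps of an r-permutation π of {1ʳ, …, nʳ}, and this creates a new descent except in the d(π)
-- gaps that follow a descent or end the word. Hence a(n+1, k) + (k-1) a(n, k-1) = k a(n, k) + (r n + 1) a(n, k-1),
-- which says that X = A⁽ʳ⁾ satisfies the first-order equation ∂X + t θX = θX + r t z ∂X + t X, where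
-- ∂ = d/dz and θ = t d/dt. Differentiating it in z shows that ∂X solves the linear equation 𝓛Y = 𝓜Y with
-- 𝓛Y = ∂Y + t θY and 𝓜Y = θY + (1 + r) t Y + r t z ∂Y, and a computation with the derivation rules shows that
-- G = X^r (X - 1) + t X^r solves it too. Since 𝓛Y = 𝓜Y determines the coefficient of z^(n+1) from that of
-- z^n, and both ∂X and G reduce to t at z = 0, ∂X = G.

open import Algebra.Bundles using (CommutativeRing)
open import Data.Nat using (ℕ)

-- Formal power series

module FiniteSum {c ℓ} (R : CommutativeRing c ℓ) where

  open import Data.Nat as ℕ using (ℕ; zero; suc; _∸_; _<_; z<s; s<s; s≤s)
  open import Data.Nat.Properties using (+-∸-assoc; n∸n≡0; +-suc; m+[n∸m]≡n)
  import Data.Nat.Properties as ℕₚ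
  open import Function using (_∘_)
  import Relation.Binary.PropositionalEquality as ≡
  open CommutativeRing R
  open import Relation.Binary.Reasoning.Setoid setoid
  open import Algebra.Properties.CommutativeSemigroup +-commutativeSemigroup
    using () renaming (interchange to +-interchange)

  ∑ : ℕ → (ℕ → Carrier) → Carrier
  ∑ zero    f = 0#
  ∑ (suc n) f = f 0 + ∑ n (f ∘ suc)

  ∑-cong-< : ∀ n {f g} → (∀ i → i < n → f i ≈ g i) → ∑ n f ≈ ∑ n g
  ∑-cong-< zero    f≈g = refl
  ∑-cong-< (suc n) f≈g = +-cong (f≈g 0 z<s) (∑-cong-< n (λ i i<n → f≈g (suc i) (s<s i<n)))

  ∑-cong : ∀ n {f g} → (∀ i → f i ≈ g i) → ∑ n f ≈ ∑ n g
  ∑-cong n f≈g = ∑-cong-< n (λ i _ → f≈g i)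

  ∑-init-last : ∀ n f → ∑ (suc n) f ≈ ∑ n f + f n
  ∑-init-last zero    f = trans (+-identityʳ _) (sym (+-identityˡ _))
  ∑-init-last (suc n) f = begin
    f 0 + ∑ (suc n) (f ∘ suc)       ≈⟨ +-congˡ (∑-init-last n (f ∘ suc)) ⟩
    f 0 + (∑ n (f ∘ suc) + f (suc n)) ≈⟨ +-assoc _ _ _ ⟨
    ∑ (suc n) f + f (suc n)           ∎

  ∑-homo : (h : Carrier → Carrier) → h 0# ≈ 0# → (∀ x y → h (x + y) ≈ h x + h y) →
           ∀ n f → h (∑ n f) ≈ ∑ n (h ∘ f)
  ∑-homo h h0 h+ zero    f = h0
  ∑-homo h h0 h+ (suc n) f = trans (h+ _ _) (+-congˡ (∑-homo h h0 h+ n (f ∘ suc)))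

  ∑-zero : ∀ n → ∑ n (λ _ → 0#) ≈ 0#
  ∑-zero zero    = refl
  ∑-zero (suc n) = trans (+-identityˡ _) (∑-zero n)

  ∑-distrib-+ : ∀ n f g → ∑ n (λ i → f i + g i) ≈ ∑ n f + ∑ n g
  ∑-distrib-+ zero    f g = sym (+-identityˡ _)
  ∑-distrib-+ (suc n) f g = trans (+-congˡ (∑-distrib-+ n (f ∘ suc) (g ∘ suc)))
                                  (+-interchange (f 0) (g 0) _ _)

  *-distribˡ-∑ : ∀ a n f → a * ∑ n f ≈ ∑ n (λ i → a * f i)
  *-distribˡ-∑ a = ∑-homo (a *_) (zeroʳ a) (distribˡ a)

  *-distribʳ-∑ : ∀ a n f → ∑ n f * a ≈ ∑ n (λ i → f i * a)
  *-distribʳ-∑ a n f = trans (*-comm _ a) (trans (*-distribˡ-∑ a n f) (∑-cong n (λ i → *-comm a (f i))))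

  ∑-reverse : ∀ n f → ∑ n f ≈ ∑ n (λ i → f (n ∸ suc i))
  ∑-reverse zero    f = refl
  ∑-reverse (suc n) f = begin
    f 0 + ∑ n (f ∘ suc)                      ≈⟨ +-congˡ (∑-reverse n (f ∘ suc)) ⟩
    f 0 + ∑ n (λ i → f (suc (n ∸ suc i)))    ≈⟨ +-comm _ _ ⟩
    ∑ n (λ i → f (suc (n ∸ suc i))) + f 0    ≈⟨ +-cong (∑-cong-< n (λ i i<n → reflexive (≡.cong f (≡.sym (+-∸-assoc 1 i<n)))))
                                                      (reflexive (≡.cong f (≡.sym (n∸n≡0 n)))) ⟩
    ∑ n (λ i → f (n ∸ i)) + f (n ∸ n)        ≈⟨ ∑-init-last n (λ i → f (n ∸ i)) ⟨
    ∑ (suc n) (λ i → f (suc n ∸ suc i))      ∎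

  ∑-triangle : ∀ N (f : ℕ → ℕ → Carrier) →
    ∑ (suc N) (λ m → ∑ (suc m) (λ i → f i m)) ≈ ∑ (suc N) (λ i → ∑ (suc (N ∸ i)) (λ j → f i (i ℕ.+ j)))
  ∑-triangle zero    f = refl
  ∑-triangle (suc N) f = begin
    ∑ (suc (suc N)) (λ m → ∑ (suc m) (λ i → f i m))
      ≈⟨ ∑-init-last (suc N) (λ m → ∑ (suc m) (λ i → f i m)) ⟩
    ∑ (suc N) (λ m → ∑ (suc m) (λ i → f i m)) + ∑ (suc (suc N)) (λ i → f i (suc N))
      ≈⟨ +-cong (∑-triangle N f) (∑-init-last (suc N) (λ i → f i (suc N))) ⟩
    ∑ (suc N) row + (∑ (suc N) (λ i → f i (suc N)) + f (suc N) (suc N))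
      ≈⟨ +-assoc _ _ _ ⟨
    (∑ (suc N) row + ∑ (suc N) (λ i → f i (suc N))) + f (suc N) (suc N)
      ≈⟨ +-cong (∑-distrib-+ (suc N) row (λ i → f i (suc N))) (+-identityʳ _) ⟨
    ∑ (suc N) (λ i → row i + f i (suc N)) + (f (suc N) (suc N) + 0#)
      ≈⟨ +-cong (∑-cong-< (suc N) extend-row) (+-congʳ (reflexive (≡.cong (f (suc N)) (≡.sym (ℕₚ.+-identityʳ (suc N)))))) ⟩
    ∑ (suc N) row′ + ∑ 1 (λ j → f (suc N) (suc N ℕ.+ j))
      ≡⟨ ≡.cong (λ k → ∑ (suc N) row′ + ∑ (suc k) (λ j → f (suc N) (suc N ℕ.+ j))) (≡.sym (n∸n≡0 N)) ⟩
    ∑ (suc N) row′ + row′ (suc N)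
      ≈⟨ ∑-init-last (suc N) row′ ⟨
    ∑ (suc (suc N)) row′ ∎
    where
    row row′ : ℕ → Carrier
    row  i = ∑ (suc (N ∸ i)) (λ j → f i (i ℕ.+ j))
    row′ i = ∑ (suc (suc N ∸ i)) (λ j → f i (i ℕ.+ j))

    extend-row : ∀ i → i < suc N → row i + f i (suc N) ≈ row′ i
    extend-row i (s≤s i≤N) = begin
      row i + f i (suc N)
        ≈⟨ +-congˡ (reflexive (≡.cong (f i) (≡.sym (≡.trans (+-suc i (N ∸ i)) (≡.cong suc (m+[n∸m]≡n i≤N)))))) ⟩
      row i + f i (i ℕ.+ suc (N ∸ i))
        ≈⟨ ∑-init-last (suc (N ∸ i)) (λ j → f i (i ℕ.+ j)) ⟨
      ∑ (suc (suc (N ∸ i))) (λ j → f i (i ℕ.+ j))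
        ≡⟨ ≡.cong (λ k → ∑ (suc k) (λ j → f i (i ℕ.+ j))) (≡.sym (+-∸-assoc 1 i≤N)) ⟩
      row′ i ∎

module Multiples {c ℓ} (R : CommutativeRing c ℓ) where

  open import Data.Nat using (zero; suc)
  open CommutativeRing R
  open import Algebra.Properties.Semiring.Mult semiring using (_×_; ×-congʳ; ×-comm-*)

  ×-zeroʳ : ∀ n → n × 0# ≈ 0#
  ×-zeroʳ zero    = refl
  ×-zeroʳ (suc n) = trans (+-identityˡ _) (×-zeroʳ n)

  ×≈×1#* : ∀ n x → n × x ≈ (n × 1#) * x
  ×≈×1#* n x = trans (×-congʳ n (sym (*-identityʳ x))) (trans (sym (×-comm-* n x 1#)) (*-comm _ _))

module Derivation {c ℓ} (R : CommutativeRing c ℓ) where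

  open import Data.Nat using (zero; suc)
  open import Level using (_⊔_)
  open CommutativeRing R
  open import Algebra.Properties.Semiring.Mult semiring using (_×_; ×-congʳ; ×-comm-*)
  open import Algebra.Properties.Semiring.Exp semiring using (_^_)
  open import Algebra.Properties.Ring ring using (+-identityʳ-unique; -0#≈0#)
  open import Relation.Binary.Reasoning.Setoid setoid

  record IsDerivation (D : Carrier → Carrier) : Set (c ⊔ ℓ) where
    field
      cong      : ∀ {x y} → x ≈ y → D x ≈ D y
      distrib-+ : ∀ x y → D (x + y) ≈ D x + D y
      leibniz   : ∀ x y → D (x * y) ≈ D x * y + x * D y

    D-0# : D 0# ≈ 0#
    D-0# = +-identityʳ-unique (D 0#) (D 0#) (trans (sym (distrib-+ 0# 0#)) (cong (+-identityʳ 0#)))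

    D-1# : D 1# ≈ 0#
    D-1# = +-identityʳ-unique (D 1#) (D 1#) (begin
      D 1# + D 1#               ≈⟨ +-cong (*-identityʳ _) (*-identityˡ _) ⟨
      D 1# * 1# + 1# * D 1#     ≈⟨ leibniz 1# 1# ⟨
      D (1# * 1#)               ≈⟨ cong (*-identityʳ 1#) ⟩
      D 1#                      ∎)

    D-‿ : ∀ x → D (- x) ≈ - D x
    D-‿ x = begin
      D (- x)                    ≈⟨ +-identityʳ _ ⟨
      D (- x) + 0#               ≈⟨ +-congˡ (-‿inverseʳ (D x)) ⟨
      D (- x) + (D x + - D x)    ≈⟨ +-assoc _ _ _ ⟨
      (D (- x) + D x) + - D x    ≈⟨ +-congʳ (distrib-+ _ _) ⟨
      D (- x + x) + - D x        ≈⟨ +-congʳ (trans (cong (-‿inverseˡ x)) D-0#) ⟩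
      0# + - D x                 ≈⟨ +-identityˡ _ ⟩
      - D x                      ∎

    D-+-constant : ∀ {a} → D a ≈ 0# → ∀ x → D (x + a) ≈ D x
    D-+-constant Da≈0 x = trans (distrib-+ x _) (trans (+-congˡ Da≈0) (+-identityʳ _))

    D-‿1# : D (- 1#) ≈ 0#
    D-‿1# = trans (D-‿ 1#) (trans (-‿cong D-1#) -0#≈0#)

    D-× : ∀ n x → D (n × x) ≈ n × D x
    D-× zero    x = D-0#
    D-× (suc n) x = trans (distrib-+ x (n × x)) (+-congˡ (D-× n x))

    D-*-constant : ∀ {a} → D a ≈ 0# → ∀ x → D (a * x) ≈ a * D x
    D-*-constant Da≈0 x = trans (leibniz _ x) (trans (+-congʳ (trans (*-congʳ Da≈0) (zeroˡ x))) (+-identityˡ _))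

    D-^ : ∀ x m → D (x ^ suc m) ≈ suc m × (x ^ m * D x)
    D-^ x zero = begin
      D (x * 1#)                 ≈⟨ leibniz x 1# ⟩
      D x * 1# + x * D 1#        ≈⟨ +-cong (trans (*-identityʳ _) (sym (*-identityˡ _))) (trans (*-congˡ D-1#) (zeroʳ x)) ⟩
      1# * D x + 0#              ∎
    D-^ x (suc m) = begin
      D (x * x ^ suc m)                              ≈⟨ leibniz x _ ⟩
      D x * x ^ suc m + x * D (x ^ suc m)            ≈⟨ +-cong (*-comm _ _) (*-congˡ (D-^ x m)) ⟩
      x ^ suc m * D x + x * (suc m × (x ^ m * D x))  ≈⟨ +-congˡ (×-comm-* (suc m) x _) ⟩
      x ^ suc m * D x + suc m × (x * (x ^ m * D x))  ≈⟨ +-congˡ (×-congʳ (suc m) (*-assoc _ _ _)) ⟨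
      suc (suc m) × (x ^ suc m * D x)                ∎

module PowerSeries {c ℓ} (R : CommutativeRing c ℓ) where

  open import Data.Nat as ℕ using (ℕ; zero; suc; _∸_; _≤_; s≤s)
  import Data.Nat.Properties as ℕₚ
  open import Data.Product using (_,_)
  open import Algebra.Structures using (IsCommutativeRing)
  import Algebra.Construct.Pointwise ℕ as Pointwise
  import Relation.Binary.PropositionalEquality as ≡
  open CommutativeRing R
  open import Algebra.Properties.Semiring.Mult semiring using (_×_; ×-congʳ; ×-homo-+; ×-assoc-*; ×-comm-*)
  open import Algebra.Properties.CommutativeMonoid.Mult +-commutativeMonoid using (×-distrib-+)
  open import Algebra.Properties.Semiring.Exp semiring using (_^_)
  open import Relation.Binary.Reasoning.Setoid setoid
  open FiniteSum R
  open Multiples R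
  open Derivation R

  Series : Set c
  Series = ℕ → Carrier

  infix 4 _≋_
  _≋_ : Series → Series → Set ℓ
  f ≋ g = ∀ n → f n ≈ g n

  infixl 6 _⊞_
  _⊞_ : Series → Series → Series
  (f ⊞ g) n = f n + g n

  ⊟_ : Series → Series
  (⊟ f) n = - f n

  𝟘 : Series
  𝟘 _ = 0#

  constant : Carrier → Series
  constant a zero    = a
  constant a (suc n) = 0#

  𝟙 : Series
  𝟙 = constant 1#

  𝕏 : Series
  𝕏 1 = 1#
  𝕏 _ = 0#

  infixl 7 _⋆_
  _⋆_ : Series → Series → Series
  (f ⋆ g) n = ∑ (suc n) (λ i → f i * g (n ∸ i))

  ⋆-cong : ∀ {f f′ g g′} → f ≋ f′ → g ≋ g′ → f ⋆ g ≋ f′ ⋆ g′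
  ⋆-cong f≋f′ g≋g′ n = ∑-cong (suc n) (λ i → *-cong (f≋f′ i) (g≋g′ (n ∸ i)))

  ⋆-comm : ∀ f g → f ⋆ g ≋ g ⋆ f
  ⋆-comm f g n = trans (∑-reverse (suc n) (λ i → f i * g (n ∸ i)))
    (∑-cong-< (suc n) {g = λ i → g i * f (n ∸ i)} λ { i (s≤s i≤n) →
       trans (*-comm _ _) (*-congʳ (reflexive (≡.cong g (ℕₚ.m∸[m∸n]≡n i≤n)))) })

  ⋆-assoc : ∀ f g h → (f ⋆ g) ⋆ h ≋ f ⋆ (g ⋆ h)
  ⋆-assoc f g h n = begin
    ∑ (suc n) (λ m → ∑ (suc m) (λ i → f i * g (m ∸ i)) * h (n ∸ m))
      ≈⟨ ∑-cong (suc n) (λ m → *-distribʳ-∑ (h (n ∸ m)) (suc m) (λ i → f i * g (m ∸ i))) ⟩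
    ∑ (suc n) (λ m → ∑ (suc m) (λ i → f i * g (m ∸ i) * h (n ∸ m)))
      ≈⟨ ∑-triangle n (λ i m → f i * g (m ∸ i) * h (n ∸ m)) ⟩
    ∑ (suc n) (λ i → ∑ (suc (n ∸ i)) (λ j → f i * g (i ℕ.+ j ∸ i) * h (n ∸ (i ℕ.+ j))))
      ≈⟨ ∑-cong (suc n) (λ i → ∑-cong (suc (n ∸ i)) {g = λ j → f i * (g j * h (n ∸ i ∸ j))} (λ j →
           trans (*-assoc _ _ _) (*-congˡ (*-cong (reflexive (≡.cong g (ℕₚ.m+n∸m≡n i j)))
                                                   (reflexive (≡.cong h (≡.sym (ℕₚ.∸-+-assoc n i j)))))))) ⟩
    ∑ (suc n) (λ i → ∑ (suc (n ∸ i)) (λ j → f i * (g j * h (n ∸ i ∸ j))))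
      ≈⟨ ∑-cong (suc n) (λ i → *-distribˡ-∑ (f i) (suc (n ∸ i)) (λ j → g j * h (n ∸ i ∸ j))) ⟨
    (f ⋆ (g ⋆ h)) n ∎

  constant-⋆ : ∀ a g → constant a ⋆ g ≋ λ n → a * g n
  constant-⋆ a g n = trans (+-congˡ (trans (∑-cong n (λ i → zeroˡ _)) (∑-zero n))) (+-identityʳ _)

  ⋆-identityˡ : ∀ f → 𝟙 ⋆ f ≋ f
  ⋆-identityˡ f n = trans (constant-⋆ 1# f n) (*-identityˡ _)

  𝕏-⋆-zero : ∀ g → (𝕏 ⋆ g) 0 ≈ 0#
  𝕏-⋆-zero g = trans (+-identityʳ _) (zeroˡ _)

  𝕏-⋆-suc : ∀ g n → (𝕏 ⋆ g) (suc n) ≈ g n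
  𝕏-⋆-suc g n = begin
    0# * g (suc n) + (1# * g n + ∑ n (λ i → 0# * g (n ∸ suc i)))
      ≈⟨ +-cong (zeroˡ _) (+-cong (*-identityˡ _) (trans (∑-cong n (λ i → zeroˡ _)) (∑-zero n))) ⟩
    0# + (g n + 0#)   ≈⟨ trans (+-identityˡ _) (+-identityʳ _) ⟩
    g n               ∎

  ⋆-distribʳ : ∀ f g h → (g ⊞ h) ⋆ f ≋ (g ⋆ f) ⊞ (h ⋆ f)
  ⋆-distribʳ f g h n = trans (∑-cong (suc n) {g = λ i → g i * f (n ∸ i) + h i * f (n ∸ i)} (λ i → distribʳ _ _ _))
                             (∑-distrib-+ (suc n) (λ i → g i * f (n ∸ i)) (λ i → h i * f (n ∸ i)))

  ⋆-isCommutativeRing : IsCommutativeRing _≋_ _⊞_ _⋆_ ⊟_ 𝟘 𝟙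
  ⋆-isCommutativeRing = record
    { isRing = record
      { +-isAbelianGroup = Pointwise.isAbelianGroup +-isAbelianGroup
      ; *-cong           = ⋆-cong
      ; *-assoc          = ⋆-assoc
      ; *-identity       = ⋆-identityˡ , λ f n → trans (⋆-comm f 𝟙 n) (⋆-identityˡ f n)
      ; distrib          = (λ f g h n → trans (⋆-comm f (g ⊞ h) n)
                                          (trans (⋆-distribʳ f g h n) (+-cong (⋆-comm g f n) (⋆-comm h f n))))
                         , ⋆-distribʳ
      }
    ; *-comm = ⋆-comm
    }

  powerSeriesRing : CommutativeRing c ℓ
  powerSeriesRing = record { isCommutativeRing = ⋆-isCommutativeRing }

  module Ring[[X]] = CommutativeRing powerSeriesRing
  open import Algebra.Properties.Semiring.Mult Ring[[X]].semiring using () renaming (_×_ to _×ₛ_)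
  open import Algebra.Properties.Semiring.Exp Ring[[X]].semiring using () renaming (_^_ to _^ₛ_)

  ×ₛ-pointwise : ∀ m f n → (m ×ₛ f) n ≈ m × f n
  ×ₛ-pointwise zero    f n = refl
  ×ₛ-pointwise (suc m) f n = +-congˡ (×ₛ-pointwise m f n)

  ^ₛ-at-0 : ∀ f m → (f ^ₛ m) 0 ≈ f 0 ^ m
  ^ₛ-at-0 f zero    = refl
  ^ₛ-at-0 f (suc m) = trans (+-identityʳ _) (*-congˡ (^ₛ-at-0 f m))

  ∂ : Series → Series
  ∂ f n = suc n × f (suc n)

  θ : Series → Series
  θ f n = n × f n

  lift : (Carrier → Carrier) → Series → Series
  lift D f n = D (f n)

  private
    ×-split : ∀ {n i} x y → i ≤ n → n × (x * y) ≈ i × x * y + x * (n ∸ i) × y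
    ×-split {n} {i} x y i≤n = begin
      n × (x * y)                          ≡⟨ ≡.cong (_× (x * y)) (≡.sym (ℕₚ.m+[n∸m]≡n i≤n)) ⟩
      (i ℕ.+ (n ∸ i)) × (x * y)            ≈⟨ ×-homo-+ (x * y) i (n ∸ i) ⟩
      i × (x * y) + (n ∸ i) × (x * y)      ≈⟨ +-cong (×-assoc-* i x y) (×-comm-* (n ∸ i) x y) ⟨
      i × x * y + x * (n ∸ i) × y          ∎

    ×-leibniz : ∀ n f g → n × (f ⋆ g) n ≈ ((θ f ⋆ g) ⊞ (f ⋆ θ g)) n
    ×-leibniz n f g = begin
      n × (f ⋆ g) n
        ≈⟨ ∑-homo (n ×_) (×-zeroʳ n) (λ x y → ×-distrib-+ x y n) (suc n) (λ i → f i * g (n ∸ i)) ⟩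
      ∑ (suc n) (λ i → n × (f i * g (n ∸ i)))
        ≈⟨ ∑-cong-< (suc n) (λ { i (s≤s i≤n) → ×-split (f i) (g (n ∸ i)) i≤n }) ⟩
      ∑ (suc n) (λ i → θ f i * g (n ∸ i) + f i * θ g (n ∸ i))
        ≈⟨ ∑-distrib-+ (suc n) (λ i → θ f i * g (n ∸ i)) (λ i → f i * θ g (n ∸ i)) ⟩
      ((θ f ⋆ g) ⊞ (f ⋆ θ g)) n ∎

  θ-isDerivation : Derivation.IsDerivation powerSeriesRing θ
  θ-isDerivation = record
    { cong      = λ f≋g n → ×-congʳ n (f≋g n)
    ; distrib-+ = λ f g n → ×-distrib-+ (f n) (g n) n
    ; leibniz   = λ f g n → ×-leibniz n f g
    }

  ∂-isDerivation : Derivation.IsDerivation powerSeriesRing ∂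
  ∂-isDerivation = record
    { cong      = λ f≋g n → ×-congʳ (suc n) (f≋g (suc n))
    ; distrib-+ = λ f g n → ×-distrib-+ (f (suc n)) (g (suc n)) (suc n)
    ; leibniz   = leibniz
    }
    where
    -- the i = 0 term of the first sum and the i = n + 1 term of the second vanish
    leibniz : ∀ f g → ∂ (f ⋆ g) ≋ (∂ f ⋆ g) ⊞ (f ⋆ ∂ g)
    leibniz f g n = begin
      suc n × (f ⋆ g) (suc n)
        ≈⟨ ×-leibniz (suc n) f g ⟩
      (θ f ⋆ g) (suc n) + (f ⋆ θ g) (suc n)
        ≈⟨ +-cong (+-congʳ (zeroˡ _)) (∑-init-last (suc n) (λ i → f i * θ g (suc n ∸ i))) ⟩
      0# + (∂ f ⋆ g) n + (∑ (suc n) (λ i → f i * θ g (suc n ∸ i)) + f (suc n) * θ g (n ∸ n))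
        ≈⟨ +-cong (+-identityˡ _) (+-congˡ (trans (*-congˡ (reflexive (≡.cong (λ k → k × g k) (ℕₚ.n∸n≡0 n)))) (zeroʳ _))) ⟩
      (∂ f ⋆ g) n + (∑ (suc n) (λ i → f i * θ g (suc n ∸ i)) + 0#)
        ≈⟨ +-congˡ (trans (+-identityʳ _) (∑-cong-< (suc n) {g = λ i → f i * ∂ g (n ∸ i)} (λ { i (s≤s i≤n) →
             *-congˡ (reflexive (≡.cong (λ k → k × g k) (ℕₚ.+-∸-assoc 1 i≤n))) }))) ⟩
      ((∂ f ⋆ g) ⊞ (f ⋆ ∂ g)) n ∎

  lift-isDerivation : ∀ {D} → IsDerivation D → Derivation.IsDerivation powerSeriesRing (lift D)
  lift-isDerivation {D} D-derivation = record
    { cong      = λ f≋g n → cong (f≋g n)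
    ; distrib-+ = λ f g n → distrib-+ (f n) (g n)
    ; leibniz   = λ f g n → begin
        D ((f ⋆ g) n)
          ≈⟨ ∑-homo D D-0# distrib-+ (suc n) (λ i → f i * g (n ∸ i)) ⟩
        ∑ (suc n) (λ i → D (f i * g (n ∸ i)))
          ≈⟨ ∑-cong (suc n) {g = λ i → D (f i) * g (n ∸ i) + f i * D (g (n ∸ i))} (λ i → leibniz (f i) (g (n ∸ i))) ⟩
        ∑ (suc n) (λ i → D (f i) * g (n ∸ i) + f i * D (g (n ∸ i)))
          ≈⟨ ∑-distrib-+ (suc n) (λ i → D (f i) * g (n ∸ i)) (λ i → f i * D (g (n ∸ i))) ⟩
        ((lift D f ⋆ g) ⊞ (f ⋆ lift D g)) n ∎
    }
    where open IsDerivation D-derivation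

  ∂-lift : ∀ {D} → IsDerivation D → ∀ f → ∂ (lift D f) ≋ lift D (∂ f)
  ∂-lift D-derivation f n = sym (D-× (suc n) (f (suc n)))
    where open IsDerivation D-derivation

  ∂-constant : ∀ a → ∂ (constant a) ≋ 𝟘
  ∂-constant a n = ×-zeroʳ (suc n)

  ∂-𝕏 : ∂ 𝕏 ≋ 𝟙
  ∂-𝕏 zero    = +-identityʳ 1#
  ∂-𝕏 (suc n) = ×-zeroʳ (suc (suc n))

  θ-𝕏 : θ 𝕏 ≋ 𝕏
  θ-𝕏 zero          = refl
  θ-𝕏 (suc zero)    = +-identityʳ 1#
  θ-𝕏 (suc (suc n)) = ×-zeroʳ (suc (suc n))

  ⋆-at-0 : ∀ f g → (f ⋆ g) 0 ≈ f 0 * g 0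
  ⋆-at-0 f g = +-identityʳ _

  θ-constant : ∀ a → θ (constant a) ≋ 𝟘
  θ-constant a zero    = refl
  θ-constant a (suc n) = ×-zeroʳ (suc n)

-- D plays the role of ∂/∂z and Θ that of t ∂/∂t.
module TwoSolutions
  {c ℓ} (R : CommutativeRing c ℓ)
  (D Θ : CommutativeRing.Carrier R → CommutativeRing.Carrier R)
  (D-derivation : Derivation.IsDerivation R D) (Θ-derivation : Derivation.IsDerivation R Θ)
  (s : ℕ) (t z : CommutativeRing.Carrier R)
  where

  open import Data.Nat using (suc)
  open CommutativeRing R
  open import Algebra.Properties.Semiring.Mult semiring using (_×_; ×-congʳ)
  open import Algebra.Properties.Semiring.Exp semiring using (_^_)
  open import Algebra.Solver.Ring.NaturalCoefficients.Default commutativeSemiring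
  open import Relation.Binary.Reasoning.Setoid setoid
  open Multiples R
  open Derivation R
  open IsDerivation D-derivation
  open IsDerivation Θ-derivation using ()
    renaming (distrib-+ to Θ-distrib-+; leibniz to Θ-leibniz; D-‿1# to Θ-‿1#; D-+-constant to Θ-+-constant; D-^ to Θ-^)

  ρ : Carrier
  ρ = suc s × 1#

  𝓛 𝓜 : Carrier → Carrier
  𝓛 Y = D Y + t * Θ Y
  𝓜 Y = Θ Y + t * Y + ρ * (t * Y) + ρ * (t * (z * D Y))

  module _ (X : Carrier) where

    Pde : Set ℓ
    Pde = D X + t * Θ X ≈ Θ X + ρ * (t * (z * D X)) + t * X

    G : Carrier
    G = X ^ suc s * (X - 1#) + t * X ^ suc s

  module _ {X : Carrier} (Dt≈0 : D t ≈ 0#) (Dz≈1 : D z ≈ 1#) (Θt≈t : Θ t ≈ t) (DΘX≈ΘDX : D (Θ X) ≈ Θ (D X)) where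

    Dρ≈0 : D ρ ≈ 0#
    Dρ≈0 = trans (D-× (suc s) 1#) (trans (×-congʳ (suc s) D-1#) (×-zeroʳ (suc s)))

    differentiated-pde : Pde X → D (D X) + t * Θ (D X) ≈ Θ (D X) + ρ * (t * (D X + z * D (D X))) + t * D X
    differentiated-pde pde = begin
      D (D X) + t * Θ (D X)                          ≈⟨ +-congˡ (*-congˡ DΘX≈ΘDX) ⟨
      D (D X) + t * D (Θ X)                          ≈⟨ +-congˡ (D-*-constant Dt≈0 (Θ X)) ⟨
      D (D X) + D (t * Θ X)                          ≈⟨ distrib-+ _ _ ⟨
      D (D X + t * Θ X)                              ≈⟨ cong pde ⟩
      D (Θ X + ρ * (t * (z * D X)) + t * X)          ≈⟨ distrib-+ _ _ ⟩
      D (Θ X + ρ * (t * (z * D X))) + D (t * X)      ≈⟨ +-cong (distrib-+ _ _) (D-*-constant Dt≈0 X) ⟩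
      D (Θ X) + D (ρ * (t * (z * D X))) + t * D X    ≈⟨ +-congʳ (+-cong DΘX≈ΘDX D-ρtz) ⟩
      Θ (D X) + ρ * (t * (D X + z * D (D X))) + t * D X ∎
      where
      D-ρtz : D (ρ * (t * (z * D X))) ≈ ρ * (t * (D X + z * D (D X)))
      D-ρtz = trans (D-*-constant Dρ≈0 _) (*-congˡ (trans (D-*-constant Dt≈0 _) (*-congˡ
                (trans (leibniz z (D X)) (+-congʳ (trans (*-congʳ Dz≈1) (*-identityˡ _)))))))

    𝓛∂X≈𝓜∂X : Pde X → 𝓛 (D X) ≈ 𝓜 (D X)
    𝓛∂X≈𝓜∂X pde = trans (differentiated-pde pde)
      (solve 6 (λ ΘDX ρ t DX z DDX →
                 ΘDX :+ ρ :* (t :* (DX :+ z :* DDX)) :+ t :* DX :=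
                 ΘDX :+ t :* DX :+ ρ :* (t :* DX) :+ ρ :* (t :* (z :* DDX)))
             refl (Θ (D X)) ρ t (D X) z (D (D X)))

    private
      P G′ : Carrier
      P  = X ^ s
      G′ = ρ * P * (X - 1#) + X * P + t * ρ * P

      D-X^r : D (X ^ suc s) ≈ ρ * (P * D X)
      D-X^r = trans (D-^ X s) (×≈×1#* (suc s) _)

      Θ-X^r : Θ (X ^ suc s) ≈ ρ * (P * Θ X)
      Θ-X^r = trans (Θ-^ X s) (×≈×1#* (suc s) _)

      D-X-1 : D (X - 1#) ≈ D X
      D-X-1 = D-+-constant D-‿1# X

      Θ-X-1 : Θ (X - 1#) ≈ Θ X
      Θ-X-1 = Θ-+-constant Θ-‿1# X

    DG : D (G X) ≈ G′ * D X
    DG = begin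
      D (G X)                                             ≈⟨ distrib-+ _ _ ⟩
      D (X ^ suc s * (X - 1#)) + D (t * X ^ suc s)
        ≈⟨ +-cong (leibniz _ _) (D-*-constant Dt≈0 _) ⟩
      D (X ^ suc s) * (X - 1#) + X ^ suc s * D (X - 1#) + t * D (X ^ suc s)
        ≈⟨ +-cong (+-cong (*-congʳ D-X^r) (*-congˡ D-X-1)) (*-congˡ D-X^r) ⟩
      ρ * (P * D X) * (X - 1#) + X * P * D X + t * (ρ * (P * D X))
        ≈⟨ solve 6 (λ ρ P DX X-1 X t →
                     ρ :* (P :* DX) :* X-1 :+ X :* P :* DX :+ t :* (ρ :* (P :* DX)) :=
                     (ρ :* P :* X-1 :+ X :* P :+ t :* ρ :* P) :* DX)
                   refl ρ P (D X) (X - 1#) X t ⟩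
      G′ * D X ∎

    ΘG : Θ (G X) ≈ G′ * Θ X + t * (X * P)
    ΘG = begin
      Θ (G X)                                             ≈⟨ Θ-distrib-+ _ _ ⟩
      Θ (X ^ suc s * (X - 1#)) + Θ (t * X ^ suc s)
        ≈⟨ +-cong (Θ-leibniz _ _) (Θ-leibniz _ _) ⟩
      Θ (X ^ suc s) * (X - 1#) + X ^ suc s * Θ (X - 1#) + (Θ t * X ^ suc s + t * Θ (X ^ suc s))
        ≈⟨ +-cong (+-cong (*-congʳ Θ-X^r) (*-congˡ Θ-X-1)) (+-cong (*-congʳ Θt≈t) (*-congˡ Θ-X^r)) ⟩
      ρ * (P * Θ X) * (X - 1#) + X * P * Θ X + (t * (X * P) + t * (ρ * (P * Θ X)))
        ≈⟨ solve 6 (λ ρ P ΘX X-1 X t →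
                     ρ :* (P :* ΘX) :* X-1 :+ X :* P :* ΘX :+ (t :* (X :* P) :+ t :* (ρ :* (P :* ΘX))) :=
                     (ρ :* P :* X-1 :+ X :* P :+ t :* ρ :* P) :* ΘX :+ t :* (X :* P))
                   refl ρ P (Θ X) (X - 1#) X t ⟩
      G′ * Θ X + t * (X * P) ∎

    -- after adding X * P * (1 - 1) this is an identity of polynomials in X, P, - 1#, t, ρ
    G-identity : X * G′ + t * (X * P) ≈ X * P + (1# + ρ) * G X
    G-identity = begin
      X * G′ + t * (X * P)                             ≈⟨ +-identityʳ _ ⟨
      X * G′ + t * (X * P) + 0#                        ≈⟨ +-congˡ (trans (*-congˡ (-‿inverseʳ 1#)) (zeroʳ _)) ⟨
      X * G′ + t * (X * P) + X * P * (1# + - 1#)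
        ≈⟨ solve 5 (λ X P m t ρ →
                     X :* (ρ :* P :* (X :+ m) :+ X :* P :+ t :* ρ :* P) :+ t :* (X :* P) :+ X :* P :* (con 1 :+ m) :=
                     X :* P :+ (con 1 :+ ρ) :* (X :* P :* (X :+ m) :+ t :* (X :* P)))
                   refl X P (- 1#) t ρ ⟩
      X * P + (1# + ρ) * G X                           ∎

    𝓛G≈𝓜G : Pde X → 𝓛 (G X) ≈ 𝓜 (G X)
    𝓛G≈𝓜G pde = begin
      D (G X) + t * Θ (G X)
        ≈⟨ +-cong DG (*-congˡ ΘG) ⟩
      G′ * D X + t * (G′ * Θ X + t * (X * P))
        ≈⟨ solve 6 (λ G′ DX t ΘX X P → G′ :* DX :+ t :* (G′ :* ΘX :+ t :* (X :* P)) :=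
                                        G′ :* (DX :+ t :* ΘX) :+ t :* (t :* (X :* P)))
                   refl G′ (D X) t (Θ X) X P ⟩
      G′ * (D X + t * Θ X) + t * (t * (X * P))
        ≈⟨ +-congʳ (*-congˡ pde) ⟩
      G′ * (Θ X + ρ * (t * (z * D X)) + t * X) + t * (t * (X * P))
        ≈⟨ solve 8 (λ G′ ΘX ρ t z DX X P →
                     G′ :* (ΘX :+ ρ :* (t :* (z :* DX)) :+ t :* X) :+ t :* (t :* (X :* P)) :=
                     G′ :* ΘX :+ ρ :* (t :* (z :* (G′ :* DX))) :+ t :* (X :* G′ :+ t :* (X :* P)))
                   refl G′ (Θ X) ρ t z (D X) X P ⟩
      G′ * Θ X + ρ * (t * (z * (G′ * D X))) + t * (X * G′ + t * (X * P))
        ≈⟨ +-congˡ (*-congˡ G-identity) ⟩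
      G′ * Θ X + ρ * (t * (z * (G′ * D X))) + t * (X * P + (1# + ρ) * G X)
        ≈⟨ solve 8 (λ G′ ΘX ρ t z DX XP G →
                     G′ :* ΘX :+ ρ :* (t :* (z :* (G′ :* DX))) :+ t :* (XP :+ (con 1 :+ ρ) :* G) :=
                     (G′ :* ΘX :+ t :* XP) :+ t :* G :+ ρ :* (t :* G) :+ ρ :* (t :* (z :* (G′ :* DX))))
                   refl G′ (Θ X) ρ t z (D X) (X * P) (G X) ⟩
      (G′ * Θ X + t * (X * P)) + t * G X + ρ * (t * G X) + ρ * (t * (z * (G′ * D X)))
        ≈⟨ +-cong (+-congʳ (+-congʳ ΘG)) (*-congˡ (*-congˡ (*-congˡ DG))) ⟨
      𝓜 (G X) ∎

module Fractions where

  open import Data.Nat as ℕ using (ℕ; zero; suc; NonZero; _!)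
  open import Data.Nat.Properties using (_!≢0; m*n≢0)
  open import Data.Integer as ℤ using (+_)
  import Data.Integer.Properties as ℤₚ
  open import Data.Rational using (ℚ; _/_; _+_; _*_; 0ℚ; 1ℚ; 1/_; fromℚᵘ; ≢-nonZero)
  open import Data.Rational.Properties
    using (+-*-commutativeRing; fromℚᵘ-cong; fromℚᵘ-injective; toℚᵘ-fromℚᵘ; fromℚᵘ-toℚᵘ; toℚᵘ-homo-+;
           0/n≡0; *-zeroˡ; *-identityˡ; *-distribʳ-+; *-assoc; *-inverseˡ)
  import Data.Rational.Unnormalised as ℚᵘ
  import Data.Rational.Unnormalised.Properties as ℚᵘₚ
  open import Data.Nat.Solver using (module +-*-Solver)
  open +-*-Solver
  open import Algebra.Properties.Semiring.Mult (CommutativeRing.semiring +-*-commutativeRing) using (_×_)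
  open import Relation.Binary.PropositionalEquality
  open ≡-Reasoning

  fromℚᵘ-homo-+ : ∀ x y → fromℚᵘ (x ℚᵘ.+ y) ≡ fromℚᵘ x + fromℚᵘ y
  fromℚᵘ-homo-+ x y = trans (fromℚᵘ-cong (ℚᵘₚ.≃-sym (ℚᵘₚ.≃-trans (toℚᵘ-homo-+ (fromℚᵘ x) (fromℚᵘ y))
                                                               (ℚᵘₚ.+-cong (toℚᵘ-fromℚᵘ x) (toℚᵘ-fromℚᵘ y)))))
                            (fromℚᵘ-toℚᵘ _)

  +-/ : ∀ a b d .{{_ : NonZero d}} → (+ a / d) + (+ b / d) ≡ + (a ℕ.+ b) / d
  +-/ a b d@(suc d-1) = trans (sym (fromℚᵘ-homo-+ (ℚᵘ.mkℚᵘ (+ a) d-1) (ℚᵘ.mkℚᵘ (+ b) d-1)))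
    (fromℚᵘ-cong {ℚᵘ.mkℚᵘ (+ a) d-1 ℚᵘ.+ ℚᵘ.mkℚᵘ (+ b) d-1} {ℚᵘ.mkℚᵘ (+ (a ℕ.+ b)) d-1} (ℚᵘ.*≡* (sym ℤ-identity)))
    where
    ℤ-identity : + (a ℕ.+ b) ℤ.* + (d ℕ.* d) ≡ (+ a ℤ.* + d ℤ.+ + b ℤ.* + d) ℤ.* + d
    ℤ-identity = begin
      + (a ℕ.+ b) ℤ.* + (d ℕ.* d)               ≡⟨ ℤₚ.pos-* (a ℕ.+ b) (d ℕ.* d) ⟨
      + ((a ℕ.+ b) ℕ.* (d ℕ.* d))               ≡⟨ cong +_ (solve 3 (λ a b d → (a :+ b) :* (d :* d) := (a :* d :+ b :* d) :* d) refl a b d) ⟩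
      + ((a ℕ.* d ℕ.+ b ℕ.* d) ℕ.* d)           ≡⟨ ℤₚ.pos-* (a ℕ.* d ℕ.+ b ℕ.* d) d ⟩
      + (a ℕ.* d ℕ.+ b ℕ.* d) ℤ.* + d           ≡⟨ cong (ℤ._* + d) (ℤₚ.pos-+ (a ℕ.* d) (b ℕ.* d)) ⟩
      (+ (a ℕ.* d) ℤ.+ + (b ℕ.* d)) ℤ.* + d     ≡⟨ cong₂ (λ x y → (x ℤ.+ y) ℤ.* + d) (ℤₚ.pos-* a d) (ℤₚ.pos-* b d) ⟩
      (+ a ℤ.* + d ℤ.+ + b ℤ.* + d) ℤ.* + d     ∎

  /-cancel : ∀ c a d .{{_ : NonZero c}} .{{_ : NonZero d}} → (+ (c ℕ.* a) / (c ℕ.* d)) {{m*n≢0 c d}} ≡ + a / d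
  /-cancel c@(suc c-1) a d@(suc d-1) =
    fromℚᵘ-cong {ℚᵘ.mkℚᵘ (+ (c ℕ.* a)) (d-1 ℕ.+ c-1 ℕ.* d)} {ℚᵘ.mkℚᵘ (+ a) d-1} (ℚᵘ.*≡* ℤ-identity)
    where
    ℤ-identity : + (c ℕ.* a) ℤ.* + d ≡ + a ℤ.* + (c ℕ.* d)
    ℤ-identity = begin
      + (c ℕ.* a) ℤ.* + d   ≡⟨ ℤₚ.pos-* (c ℕ.* a) d ⟨
      + (c ℕ.* a ℕ.* d)     ≡⟨ cong +_ (solve 3 (λ c a d → c :* a :* d := a :* (c :* d)) refl c a d) ⟩
      + (a ℕ.* (c ℕ.* d))   ≡⟨ ℤₚ.pos-* a (c ℕ.* d) ⟩
      + a ℤ.* + (c ℕ.* d)   ∎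

  ×-/ : ∀ m a d .{{_ : NonZero d}} → m × (+ a / d) ≡ + (m ℕ.* a) / d
  ×-/ zero    a d = sym (0/n≡0 d)
  ×-/ (suc m) a d = trans (cong (_+_ (+ a / d)) (×-/ m a d)) (+-/ a (m ℕ.* a) d)

  ×≡/1* : ∀ m q → m × q ≡ (+ m / 1) * q
  ×≡/1* zero    q = sym (*-zeroˡ q)
  ×≡/1* (suc m) q = begin
    q + m × q                      ≡⟨ cong₂ _+_ (sym (*-identityˡ q)) (×≡/1* m q) ⟩
    1ℚ * q + (+ m / 1) * q         ≡⟨ *-distribʳ-+ q 1ℚ (+ m / 1) ⟨
    (1ℚ + + m / 1) * q             ≡⟨ cong (_* q) (+-/ 1 m 1) ⟩
    (+ suc m / 1) * q              ∎

  ×-cancelˡ : ∀ n {p q} → suc n × p ≡ suc n × q → p ≡ q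
  ×-cancelˡ n {p} {q} eq = begin
    p                       ≡⟨ scale p ⟩
    (1/ c) {{c≢0}} * (c * p)  ≡⟨ cong ((1/ c) {{c≢0}} *_) (trans (sym (×≡/1* (suc n) p)) (trans eq (×≡/1* (suc n) q))) ⟩
    (1/ c) {{c≢0}} * (c * q)  ≡⟨ scale q ⟨
    q                       ∎
    where
    c = + suc n / 1
    c≢0 = ≢-nonZero {c} (λ c≡0 →
      case fromℚᵘ-injective {ℚᵘ.mkℚᵘ (+ suc n) 0} {ℚᵘ.mkℚᵘ (+ 0) 0} c≡0 of λ { (ℚᵘ.*≡* ()) })
      where open import Function using (case_of_)
    scale : ∀ x → x ≡ (1/ c) {{c≢0}} * (c * x)
    scale x = sym (trans (sym (*-assoc ((1/ c) {{c≢0}}) c x))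
                         (trans (cong (_* x) (*-inverseˡ c {{c≢0}})) (*-identityˡ x)))

  infix 7 _/!_
  _/!_ : ℕ → ℕ → ℚ
  a /! n = (+ a / n !) {{n !≢0}}

  /!-+ : ∀ a b n → a /! n + b /! n ≡ (a ℕ.+ b) /! n
  /!-+ a b n = +-/ a b (n !) {{n !≢0}}

  ×-/! : ∀ m a n → m × (a /! n) ≡ (m ℕ.* a) /! n
  ×-/! m a n = ×-/ m a (n !) {{n !≢0}}

  suc×-/!-suc : ∀ n a → suc n × (a /! suc n) ≡ a /! n
  suc×-/!-suc n a = trans (×-/! (suc n) a (suc n)) (/-cancel (suc n) a (n !) {{_}} {{n !≢0}})

  0/!≡0 : ∀ n → 0 /! n ≡ 0ℚ
  0/!≡0 n = 0/n≡0 (n !) {{n !≢0}}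

module BivariateSeries where

  open import Data.Nat using (zero; suc)
  open import Data.Rational using (ℚ; _+_)
  open import Data.Rational.Properties using (+-*-commutativeRing)
  open import Relation.Binary.PropositionalEquality
  open import Defs using (tS)

  module ℚ[[t]]   = PowerSeries +-*-commutativeRing
  module ℚ[[t,z]] = PowerSeries ℚ[[t]].powerSeriesRing

  open import Algebra.Properties.Semiring.Mult (CommutativeRing.semiring +-*-commutativeRing) using (_×_)
  open import Algebra.Properties.Semiring.Mult (CommutativeRing.semiring ℚ[[t,z]].powerSeriesRing)
    using () renaming (×-assoc-* to ×₂-assoc-*)
  open ℚ[[t,z]] using (_⋆_; _≋_)

  Bivariate : Set
  Bivariate = ℕ → ℕ → ℚ

  D Θ : Bivariate → Bivariate
  D = ℚ[[t,z]].∂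
  Θ = ℚ[[t,z]].lift ℚ[[t]].θ

  t z : Bivariate
  t = ℚ[[t,z]].constant ℚ[[t]].𝕏
  z = ℚ[[t,z]].𝕏

  D-derivation : Derivation.IsDerivation ℚ[[t,z]].powerSeriesRing D
  D-derivation = ℚ[[t,z]].∂-isDerivation

  Θ-derivation : Derivation.IsDerivation ℚ[[t,z]].powerSeriesRing Θ
  Θ-derivation = ℚ[[t,z]].lift-isDerivation ℚ[[t]].θ-isDerivation

  Dt≈0 : D t ≋ ℚ[[t,z]].𝟘
  Dt≈0 = ℚ[[t,z]].∂-constant ℚ[[t]].𝕏

  Dz≈1 : D z ≋ ℚ[[t,z]].𝟙
  Dz≈1 = ℚ[[t,z]].∂-𝕏

  Θt≈t : Θ t ≋ t
  Θt≈t zero    = ℚ[[t]].θ-𝕏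
  Θt≈t (suc n) = λ k → Multiples.×-zeroʳ +-*-commutativeRing k

  DΘ≈ΘD : ∀ X → D (Θ X) ≋ Θ (D X)
  DΘ≈ΘD = ℚ[[t,z]].∂-lift ℚ[[t]].θ-isDerivation

  D-coeff : ∀ W n k → D W n k ≡ suc n × W (suc n) k
  D-coeff W n = ℚ[[t]].×ₛ-pointwise (suc n) (W (suc n))

  t⋆-coeff : ∀ W n k → (t ⋆ W) n k ≡ tS W n k
  t⋆-coeff W n zero    = trans (ℚ[[t,z]].constant-⋆ ℚ[[t]].𝕏 W n zero) (ℚ[[t]].𝕏-⋆-zero (W n))
  t⋆-coeff W n (suc k) = trans (ℚ[[t,z]].constant-⋆ ℚ[[t]].𝕏 W n (suc k)) (ℚ[[t]].𝕏-⋆-suc (W n) k)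

  z⋆D-coeff : ∀ W n k → (z ⋆ D W) n k ≡ n × W n k
  z⋆D-coeff W zero    k = ℚ[[t,z]].𝕏-⋆-zero (D W) k
  z⋆D-coeff W (suc n) k = trans (ℚ[[t,z]].𝕏-⋆-suc (D W) n k) (D-coeff W n k)

  tS-row : ∀ {V V′ : Bivariate} n → (∀ k → V n k ≡ V′ n k) → ∀ k → tS V n k ≡ tS V′ n k
  tS-row n row zero    = refl
  tS-row n row (suc k) = row k

  module Equation (s : ℕ) where

    open TwoSolutions ℚ[[t,z]].powerSeriesRing D Θ D-derivation Θ-derivation s t z public

    ρ⋆-coeff : ∀ W n k → (ρ ⋆ W) n k ≡ suc s × W n k
    ρ⋆-coeff W n k = trans (×₂-assoc-* (suc s) ℚ[[t,z]].𝟙 W n k)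
      (trans (ℚ[[t,z]].×ₛ-pointwise (suc s) (ℚ[[t,z]].𝟙 ⋆ W) n k)
        (trans (ℚ[[t]].×ₛ-pointwise (suc s) ((ℚ[[t,z]].𝟙 ⋆ W) n) k)
          (cong (suc s ×_) (ℚ[[t,z]].⋆-identityˡ W n k))))

    𝓛-coeff : ∀ W n k → 𝓛 W n k ≡ suc n × W (suc n) k + tS (Θ W) n k
    𝓛-coeff W n k = cong₂ _+_ (D-coeff W n k) (t⋆-coeff (Θ W) n k)

    ρtzD-coeff : ∀ W n k → (ρ ⋆ (t ⋆ (z ⋆ D W))) n k ≡ suc s × tS (λ m i → m × W m i) n k
    ρtzD-coeff W n k = trans (ρ⋆-coeff (t ⋆ (z ⋆ D W)) n k)
      (cong (suc s ×_) (trans (t⋆-coeff (z ⋆ D W) n k) (tS-row n (z⋆D-coeff W n) k)))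

    𝓜-coeff : ∀ W n k →
      𝓜 W n k ≡ k × W n k + tS W n k + suc s × tS W n k + suc s × tS (λ m i → m × W m i) n k
    𝓜-coeff W n k =
      cong₂ _+_ (cong₂ _+_ (cong (k × W n k +_) (t⋆-coeff W n k))
                           (trans (ρ⋆-coeff (t ⋆ W) n k) (cong (suc s ×_) (t⋆-coeff W n k))))
                (ρtzD-coeff W n k)

    -- the only other term of 𝓛 Y ≈ 𝓜 Y at (n, k) involving row n + 1 of Y is (n + 1) × Y (n + 1) k
    solutions-agree-on-next-row : ∀ {Y Z} → 𝓛 Y ≋ 𝓜 Y → 𝓛 Z ≋ 𝓜 Z →
      ∀ n → (∀ k → Y n k ≡ Z n k) → ∀ k → Y (suc n) k ≡ Z (suc n) k
    solutions-agree-on-next-row {Y} {Z} 𝓛Y≈𝓜Y 𝓛Z≈𝓜Z n rowₙ k =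
      Fractions.×-cancelˡ n (+-cancelʳ (tS (Θ Y) n k) _ _ (begin
        suc n × Y (suc n) k + tS (Θ Y) n k     ≡⟨ 𝓛-coeff Y n k ⟨
        𝓛 Y n k                                ≡⟨ 𝓛Y≈𝓜Y n k ⟩
        𝓜 Y n k                                ≡⟨ 𝓜-coeff Y n k ⟩
        k × Y n k + tS Y n k + suc s × tS Y n k + suc s × tS (λ m i → m × Y m i) n k
          ≡⟨ cong₂ _+_ (cong₂ _+_ (cong₂ _+_ (cong (k ×_) (rowₙ k)) (tS-row n rowₙ k)) (cong (suc s ×_) (tS-row n rowₙ k)))
                       (cong (suc s ×_) (tS-row n (λ i → cong (n ×_) (rowₙ i)) k)) ⟩
        k × Z n k + tS Z n k + suc s × tS Z n k + suc s × tS (λ m i → m × Z m i) n k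
                                               ≡⟨ 𝓜-coeff Z n k ⟨
        𝓜 Z n k                                ≡⟨ 𝓛Z≈𝓜Z n k ⟨
        𝓛 Z n k                                ≡⟨ 𝓛-coeff Z n k ⟩
        suc n × Z (suc n) k + tS (Θ Z) n k     ≡⟨ cong (suc n × Z (suc n) k +_) (tS-row n (λ i → cong (i ×_) (rowₙ i)) k) ⟨
        suc n × Z (suc n) k + tS (Θ Y) n k     ∎))
      where
      open ≡-Reasoning
      open import Algebra.Properties.Ring (CommutativeRing.ring +-*-commutativeRing) using (+-cancelʳ)

    solutions-unique : ∀ {Y Z} → 𝓛 Y ≋ 𝓜 Y → 𝓛 Z ≋ 𝓜 Z → (∀ k → Y 0 k ≡ Z 0 k) → Y ≋ Z
    solutions-unique 𝓛Y≈𝓜Y 𝓛Z≈𝓜Z row₀ zero    = row₀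
    solutions-unique 𝓛Y≈𝓜Y 𝓛Z≈𝓜Z row₀ (suc n) =
      solutions-agree-on-next-row 𝓛Y≈𝓜Y 𝓛Z≈𝓜Z n (solutions-unique 𝓛Y≈𝓜Y 𝓛Z≈𝓜Z row₀ n)

module Eulerian where

  open import Data.Nat using (suc; _+_; _*_)
  open import Relation.Binary.PropositionalEquality using (_≡_)

  record Recurrence (s : ℕ) (a : ℕ → ℕ → ℕ) : Set where
    field
      a-0-0     : a 0 0 ≡ 1
      a-0-suc   : ∀ j → a 0 (suc j) ≡ 0
      a-suc-0   : ∀ n → a (suc n) 0 ≡ 0
      a-suc-suc : ∀ n j → a (suc n) (suc j) + j * a n j ≡ suc j * a n (suc j) + suc s * (n * a n j) + a n j

module ExponentialGeneratingFunction (s : ℕ) (a : ℕ → ℕ → ℕ) (recurrence : Eulerian.Recurrence s a) where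

  open import Data.Nat as ℕ using (zero; suc)
  open import Data.Rational using (0ℚ; _+_)
  open import Data.Rational.Properties using (+-*-commutativeRing)
  open import Relation.Binary.PropositionalEquality
  open import Defs using (tS)
  open import Algebra.Properties.Semiring.Mult (CommutativeRing.semiring +-*-commutativeRing) using (_×_)
  open Fractions using (_/!_; /!-+; ×-/!; suc×-/!-suc; 0/!≡0)
  open BivariateSeries
  open ℚ[[t,z]] using (_⋆_; _≋_)
  open Equation s
  open Eulerian.Recurrence recurrence

  X : Bivariate
  X n k = a n k /! n

  coefficient-recurrence : ∀ n k →
    suc n × X (suc n) k + tS (Θ X) n k ≡ k × X n k + suc s × tS (λ m i → m × X m i) n k + tS X n k
  coefficient-recurrence n zero = begin
    suc n × (a (suc n) 0 /! suc n) + 0ℚ   ≡⟨ cong (_+ 0ℚ) (suc×-/!-suc n (a (suc n) 0)) ⟩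
    a (suc n) 0 /! n + 0ℚ                 ≡⟨ cong (λ x → x /! n + 0ℚ) (a-suc-0 n) ⟩
    0 /! n + 0ℚ                           ≡⟨ cong (_+ 0ℚ) (0/!≡0 n) ⟩
    0ℚ + 0ℚ                               ≡⟨ cong (λ x → 0ℚ + x + 0ℚ) (Multiples.×-zeroʳ +-*-commutativeRing (suc s)) ⟨
    0ℚ + suc s × 0ℚ + 0ℚ                  ∎
    where open ≡-Reasoning
  coefficient-recurrence n (suc j) = begin
    suc n × (a (suc n) (suc j) /! suc n) + j × (a n j /! n)
      ≡⟨ cong₂ _+_ (suc×-/!-suc n (a (suc n) (suc j))) (×-/! j (a n j) n) ⟩
    a (suc n) (suc j) /! n + (j ℕ.* a n j) /! n
      ≡⟨ /!-+ (a (suc n) (suc j)) (j ℕ.* a n j) n ⟩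
    (a (suc n) (suc j) ℕ.+ j ℕ.* a n j) /! n
      ≡⟨ cong (_/! n) (a-suc-suc n j) ⟩
    (suc j ℕ.* a n (suc j) ℕ.+ suc s ℕ.* (n ℕ.* a n j) ℕ.+ a n j) /! n
      ≡⟨ trans (cong (_+ a n j /! n) (/!-+ (suc j ℕ.* a n (suc j)) (suc s ℕ.* (n ℕ.* a n j)) n))
               (/!-+ (suc j ℕ.* a n (suc j) ℕ.+ suc s ℕ.* (n ℕ.* a n j)) (a n j) n) ⟨
    (suc j ℕ.* a n (suc j)) /! n + (suc s ℕ.* (n ℕ.* a n j)) /! n + a n j /! n
      ≡⟨ cong (_+ a n j /! n) (cong₂ _+_ (×-/! (suc j) (a n (suc j)) n)
                                         (trans (cong (suc s ×_) (×-/! n (a n j) n)) (×-/! (suc s) (n ℕ.* a n j) n))) ⟨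
    suc j × X n (suc j) + suc s × (n × X n j) + X n j ∎
    where open ≡-Reasoning

  pde : Pde X
  pde n k = begin
    𝓛 X n k                                                       ≡⟨ 𝓛-coeff X n k ⟩
    suc n × X (suc n) k + tS (Θ X) n k                            ≡⟨ coefficient-recurrence n k ⟩
    k × X n k + suc s × tS (λ m i → m × X m i) n k + tS X n k     ≡⟨ cong₂ _+_ (cong (k × X n k +_) (ρtzD-coeff X n k)) (t⋆-coeff X n k) ⟨
    (Θ X ℚ[[t,z]].⊞ ρ ⋆ (t ⋆ (z ⋆ D X)) ℚ[[t,z]].⊞ t ⋆ X) n k     ∎
    where open ≡-Reasoning

  private
    module R₁ = CommutativeRing ℚ[[t]].powerSeriesRing
    open R₁ using () renaming (_≈_ to _≈₁_; _+_ to _+₁_; _*_ to _*₁_; _-_ to _-₁_; 0# to 0₁)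
    open ℚ[[t]] using (𝕏; 𝟙; θ)
    open import Algebra.Properties.Semiring.Exp R₁.semiring using (^-congˡ) renaming (_^_ to _^₁_)
    open import Relation.Binary.Reasoning.Setoid R₁.setoid

    1^m≈1 : ∀ m → 𝟙 ^₁ m ≈₁ 𝟙
    1^m≈1 zero    = R₁.refl
    1^m≈1 (suc m) = R₁.trans (R₁.*-identityˡ (𝟙 ^₁ m)) (1^m≈1 m)

  X₀≈1 : X 0 ≈₁ 𝟙
  X₀≈1 zero    = cong (_/! 0) a-0-0
  X₀≈1 (suc j) = trans (cong (_/! 0) (a-0-suc j)) (0/!≡0 0)

  -- at z = 0 the equation reads (D X)₀ + t θ X₀ = θ X₀ + t X₀, and θ 1 = 0
  DX₀≈t : D X 0 ≈₁ 𝕏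
  DX₀≈t = begin
    D X 0                                          ≈⟨ R₁.+-identityʳ (D X 0) ⟨
    D X 0 +₁ 0₁                                    ≈⟨ R₁.+-congˡ {D X 0} 𝕏θX₀≈0 ⟨
    D X 0 +₁ 𝕏 *₁ θ (X 0)                          ≈⟨ R₁.+-congˡ {D X 0} (ℚ[[t,z]].⋆-at-0 t (Θ X)) ⟨
    𝓛 X 0                                          ≈⟨ pde 0 ⟩
    θ (X 0) +₁ (ρ ⋆ (t ⋆ (z ⋆ D X))) 0 +₁ (t ⋆ X) 0
      ≈⟨ R₁.+-cong (R₁.+-cong θX₀≈0 ρtzDX₀≈0) (R₁.trans (ℚ[[t,z]].⋆-at-0 t X) (R₁.*-congˡ {𝕏} X₀≈1)) ⟩
    0₁ +₁ 0₁ +₁ 𝕏 *₁ 𝟙                             ≈⟨ R₁.+-congʳ {𝕏 *₁ 𝟙} (R₁.+-identityˡ 0₁) ⟩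
    0₁ +₁ 𝕏 *₁ 𝟙                                   ≈⟨ R₁.+-identityˡ (𝕏 *₁ 𝟙) ⟩
    𝕏 *₁ 𝟙                                         ≈⟨ R₁.*-identityʳ 𝕏 ⟩
    𝕏                                              ∎
    where
    θX₀≈0 : θ (X 0) ≈₁ 0₁
    θX₀≈0 = R₁.trans (Derivation.IsDerivation.cong ℚ[[t]].θ-isDerivation X₀≈1) (ℚ[[t]].θ-constant 1ℚ)
      where open import Data.Rational using (1ℚ)
    𝕏θX₀≈0 : 𝕏 *₁ θ (X 0) ≈₁ 0₁
    𝕏θX₀≈0 = R₁.trans (R₁.*-congˡ {𝕏} θX₀≈0) (R₁.zeroʳ 𝕏)
    ρtzDX₀≈0 : (ρ ⋆ (t ⋆ (z ⋆ D X))) 0 ≈₁ 0₁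
    ρtzDX₀≈0 = begin
      (ρ ⋆ (t ⋆ (z ⋆ D X))) 0           ≈⟨ ℚ[[t,z]].⋆-at-0 ρ (t ⋆ (z ⋆ D X)) ⟩
      ρ 0 *₁ (t ⋆ (z ⋆ D X)) 0          ≈⟨ R₁.*-congˡ {ρ 0} (ℚ[[t,z]].⋆-at-0 t (z ⋆ D X)) ⟩
      ρ 0 *₁ (𝕏 *₁ (z ⋆ D X) 0)         ≈⟨ R₁.*-congˡ {ρ 0} (R₁.*-congˡ {𝕏} (ℚ[[t,z]].𝕏-⋆-zero (D X))) ⟩
      ρ 0 *₁ (𝕏 *₁ 0₁)                  ≈⟨ R₁.*-congˡ {ρ 0} (R₁.zeroʳ 𝕏) ⟩
      ρ 0 *₁ 0₁                         ≈⟨ R₁.zeroʳ (ρ 0) ⟩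
      0₁                                ∎

  G₀≈t : G X 0 ≈₁ 𝕏
  G₀≈t = begin
    (X ^ suc s ⋆ (X ℚ[[t,z]].⊞ ℚ[[t,z]].⊟ ℚ[[t,z]].𝟙)) 0 +₁ (t ⋆ X ^ suc s) 0
      ≈⟨ R₁.+-cong (ℚ[[t,z]].⋆-at-0 (X ^ suc s) (X ℚ[[t,z]].⊞ ℚ[[t,z]].⊟ ℚ[[t,z]].𝟙)) (ℚ[[t,z]].⋆-at-0 t (X ^ suc s)) ⟩
    (X ^ suc s) 0 *₁ (X 0 -₁ 𝟙) +₁ 𝕏 *₁ (X ^ suc s) 0
      ≈⟨ R₁.+-cong (R₁.*-cong X^r₀≈1 (R₁.+-congʳ {R₁.- 𝟙} X₀≈1)) (R₁.*-congˡ {𝕏} X^r₀≈1) ⟩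
    𝟙 *₁ (𝟙 -₁ 𝟙) +₁ 𝕏 *₁ 𝟙
      ≈⟨ R₁.+-cong (R₁.trans (R₁.*-identityˡ (𝟙 -₁ 𝟙)) (R₁.-‿inverseʳ 𝟙)) (R₁.*-identityʳ 𝕏) ⟩
    0₁ +₁ 𝕏                                        ≈⟨ R₁.+-identityˡ 𝕏 ⟩
    𝕏                                              ∎
    where
    open import Algebra.Properties.Semiring.Exp (CommutativeRing.semiring ℚ[[t,z]].powerSeriesRing) using (_^_)
    X^r₀≈1 : (X ^ suc s) 0 ≈₁ 𝟙
    X^r₀≈1 = R₁.trans (ℚ[[t,z]].^ₛ-at-0 X (suc s)) (R₁.trans (^-congˡ (suc s) X₀≈1) (1^m≈1 (suc s)))

  ∂X≈G : D X ≋ G X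
  ∂X≈G = solutions-unique (𝓛∂X≈𝓜∂X Dt≈0 Dz≈1 Θt≈t (DΘ≈ΘD X) pde) (𝓛G≈𝓜G Dt≈0 Dz≈1 Θt≈t (DΘ≈ΘD X) pde)
                          (λ k → trans (DX₀≈t k) (sym (G₀≈t k)))

module DefsNotation where

  open import Data.Nat using (zero; suc; _∸_)
  open import Data.List using (foldr; applyUpTo)
  open import Function using (_∘_; id)
  open import Data.Rational using (ℚ; 0ℚ; _+_; _*_)
  open import Data.Rational.Properties using (+-*-commutativeRing)
  open import Relation.Binary.PropositionalEquality
  open import Defs
  open BivariateSeries
  open ℚ[[t,z]] using (_⋆_; _⊞_; ⊟_; 𝟙)
  open import Algebra.Properties.Semiring.Exp (CommutativeRing.semiring ℚ[[t,z]].powerSeriesRing) using (_^_)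
  open FiniteSum +-*-commutativeRing using (∑)
  open FiniteSum ℚ[[t]].powerSeriesRing using () renaming (∑ to ∑₁)

  foldr-applyUpTo : ∀ (F : ℕ → ℚ) g m → foldr (λ i acc → F i + acc) 0ℚ (applyUpTo g m) ≡ ∑ m (F ∘ g)
  foldr-applyUpTo F g zero    = refl
  foldr-applyUpTo F g (suc m) = cong (F (g 0) +_) (foldr-applyUpTo F (g ∘ suc) m)

  ∑₁-at : ∀ m F k → ∑₁ m F k ≡ ∑ m (λ i → F i k)
  ∑₁-at zero    F k = refl
  ∑₁-at (suc m) F k = cong (F 0 k +_) (∑₁-at m (F ∘ suc) k)

  ⊛≡⋆ : ∀ f g n k → (f ⊛ g) n k ≡ (f ⋆ g) n k
  ⊛≡⋆ f g n k = begin
    sumTo n (λ i → sumTo k (λ l → f i l * g (n ∸ i) (k ∸ l)))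
      ≡⟨ foldr-applyUpTo (λ i → sumTo k (λ l → f i l * g (n ∸ i) (k ∸ l))) id (suc n) ⟩
    ∑ (suc n) (λ i → sumTo k (λ l → f i l * g (n ∸ i) (k ∸ l)))
      ≡⟨ FiniteSum.∑-cong +-*-commutativeRing (suc n) (λ i → foldr-applyUpTo (λ l → f i l * g (n ∸ i) (k ∸ l)) id (suc k)) ⟩
    ∑ (suc n) (λ i → (f i ℚ[[t]].⋆ g (n ∸ i)) k)
      ≡⟨ ∑₁-at (suc n) (λ i → f i ℚ[[t]].⋆ g (n ∸ i)) k ⟨
    (f ⋆ g) n k ∎
    where open ≡-Reasoning

  oneS≡𝟙 : ∀ n k → oneS n k ≡ 𝟙 n k
  oneS≡𝟙 zero    zero    = refl
  oneS≡𝟙 zero    (suc k) = refl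
  oneS≡𝟙 (suc n) k       = refl

  ^S≡^ : ∀ f m n k → (f ^S m) n k ≡ (f ^ m) n k
  ^S≡^ f zero    n k = oneS≡𝟙 n k
  ^S≡^ f (suc m) n k = trans (⊛≡⋆ f (f ^S m) n k) (ℚ[[t,z]].⋆-cong {f} {f} (λ _ _ → refl) (^S≡^ f m) n k)

  ∂z≡D : ∀ f n k → ∂z f n k ≡ D f n k
  ∂z≡D f n k = sym (trans (D-coeff f n k) (Fractions.×≡/1* (suc n) (f (suc n) k)))

  module _ (s : ℕ) where
    open Equation s using (G)

    G≡ : ∀ X n k → G X n k ≡ (((X ^S suc s) ⊛ (X ⊖ oneS)) ⊕ tS (X ^S suc s)) n k
    G≡ X n k = sym (cong₂ _+_
      (trans (⊛≡⋆ (X ^S suc s) (X ⊖ oneS) n k)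
             (ℚ[[t,z]].⋆-cong {X ^S suc s} {X ^ suc s} {X ⊖ oneS} {X ⊞ ⊟ 𝟙}
                              (^S≡^ X (suc s)) (λ n k → cong (λ u → X n k - u) (oneS≡𝟙 n k)) n k))
      (trans (tS-row n (^S≡^ X (suc s) n) k) (sym (t⋆-coeff (X ^ suc s) n k))))
      where open import Data.Rational using (_-_)

-- Counting r-permutations by descents

module ListCounting where

  open import Data.Bool using (Bool; true; false; not)
  open import Data.Bool.Properties using (T?)
  open import Data.Nat using (ℕ; zero; suc; _+_; _*_)
  import Data.Nat.Properties as ℕₚ
  open import Data.List using (List; []; _∷_; _++_; map; concatMap; filter; length; applyUpTo)
  open import Data.List.Membership.Propositional using (_∈_)
  import Data.List.Membership.Propositional.Properties as ∈ₚ
  open import Data.List.Membership.Propositional.Properties.WithK using (unique∧set⇒bag)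
  open import Data.List.Relation.Unary.Any using (here; there)
  open import Data.List.Relation.Unary.All as All using (All; _∷_)
  open import Data.List.Relation.Unary.Unique.Propositional using (Unique)
  open import Data.List.Relation.Unary.AllPairs using ([]; _∷_)
  import Data.List.Relation.Unary.Unique.Propositional.Properties as Uniqueₚ
  open import Data.List.Relation.Binary.Permutation.Propositional using (_↭_)
  import Data.List.Relation.Binary.Permutation.Propositional.Properties as ↭ₚ
  open import Data.List.Relation.Binary.BagAndSetEquality using (∼bag⇒↭)
  open import Data.Product using (_×_; _,_)
  open import Data.Empty using (⊥)
  open import Function using (_∘_; mk⇔)
  open import Relation.Binary.PropositionalEquality
  open import Data.Nat.Solver using (module +-*-Solver)
  open +-*-Solver

  private variable
    A B : Set

  indicator : Bool → ℕ
  indicator true  = 1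
  indicator false = 0

  count : (A → Bool) → List A → ℕ
  count p xs = length (filter (T? ∘ p) xs)

  sumBy : (A → ℕ) → List A → ℕ
  sumBy f []       = 0
  sumBy f (x ∷ xs) = f x + sumBy f xs

  count-∷ : ∀ (p : A → Bool) x xs → count p (x ∷ xs) ≡ indicator (p x) + count p xs
  count-∷ p x xs with p x
  ... | true  = refl
  ... | false = refl

  count≡sumBy : ∀ (p : A → Bool) xs → count p xs ≡ sumBy (indicator ∘ p) xs
  count≡sumBy p []       = refl
  count≡sumBy p (x ∷ xs) = trans (count-∷ p x xs) (cong (indicator (p x) +_) (count≡sumBy p xs))

  sumBy-++ : ∀ (f : A → ℕ) xs ys → sumBy f (xs ++ ys) ≡ sumBy f xs + sumBy f ys
  sumBy-++ f []       ys = refl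
  sumBy-++ f (x ∷ xs) ys = trans (cong (f x +_) (sumBy-++ f xs ys)) (sym (ℕₚ.+-assoc (f x) _ _))

  sumBy-cong : ∀ {f g : A → ℕ} xs → (∀ {x} → x ∈ xs → f x ≡ g x) → sumBy f xs ≡ sumBy g xs
  sumBy-cong []       f≡g = refl
  sumBy-cong (x ∷ xs) f≡g = cong₂ _+_ (f≡g (here refl)) (sumBy-cong xs (f≡g ∘ there))

  sumBy-+ : ∀ (f g : A → ℕ) xs → sumBy (λ x → f x + g x) xs ≡ sumBy f xs + sumBy g xs
  sumBy-+ f g []       = refl
  sumBy-+ f g (x ∷ xs) rewrite sumBy-+ f g xs =
    solve 4 (λ a b c d → (a :+ b) :+ (c :+ d) := (a :+ c) :+ (b :+ d)) refl (f x) (g x) (sumBy f xs) (sumBy g xs)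

  sumBy-* : ∀ c (f : A → ℕ) xs → sumBy (λ x → c * f x) xs ≡ c * sumBy f xs
  sumBy-* c f []       = sym (ℕₚ.*-zeroʳ c)
  sumBy-* c f (x ∷ xs) = trans (cong (c * f x +_) (sumBy-* c f xs)) (sym (ℕₚ.*-distribˡ-+ c (f x) (sumBy f xs)))

  sumBy-zero : ∀ (xs : List A) → sumBy (λ _ → 0) xs ≡ 0
  sumBy-zero []       = refl
  sumBy-zero (x ∷ xs) = sumBy-zero xs

  count-++ : ∀ (p : A → Bool) xs ys → count p (xs ++ ys) ≡ count p xs + count p ys
  count-++ p xs ys = trans (count≡sumBy p (xs ++ ys))
    (trans (sumBy-++ _ xs ys) (sym (cong₂ _+_ (count≡sumBy p xs) (count≡sumBy p ys))))

  count-map : ∀ (p : B → Bool) (f : A → B) xs → count p (map f xs) ≡ count (p ∘ f) xs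
  count-map p f []       = refl
  count-map p f (x ∷ xs) = trans (count-∷ p (f x) (map f xs))
    (trans (cong (indicator (p (f x)) +_) (count-map p f xs)) (sym (count-∷ (p ∘ f) x xs)))

  count-concatMap : ∀ (p : B → Bool) (f : A → List B) xs → count p (concatMap f xs) ≡ sumBy (count p ∘ f) xs
  count-concatMap p f []       = refl
  count-concatMap p f (x ∷ xs) = trans (count-++ p (f x) (concatMap f xs)) (cong (count p (f x) +_) (count-concatMap p f xs))

  count-↭ : ∀ (p : A → Bool) {xs ys} → xs ↭ ys → count p xs ≡ count p ys
  count-↭ p xs↭ys = ↭ₚ.↭-length (↭ₚ.filter-↭ (T? ∘ p) xs↭ys)

  countBelow : (ℕ → Bool) → ℕ → ℕ
  countBelow p zero    = 0
  countBelow p (suc n) = indicator (p 0) + countBelow (p ∘ suc) n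

  count-applyUpTo : ∀ (p : A → Bool) f n → count p (applyUpTo f n) ≡ countBelow (p ∘ f) n
  count-applyUpTo p f zero    = refl
  count-applyUpTo p f (suc n) = trans (count-∷ p (f 0) _) (cong (indicator (p (f 0)) +_) (count-applyUpTo p (f ∘ suc) n))

  countBelow-cong : ∀ {p q : ℕ → Bool} n → (∀ i → p i ≡ q i) → countBelow p n ≡ countBelow q n
  countBelow-cong zero    p≡q = refl
  countBelow-cong (suc n) p≡q = cong₂ _+_ (cong indicator (p≡q 0)) (countBelow-cong n (p≡q ∘ suc))

  countBelow-complement : ∀ (p : ℕ → Bool) n → countBelow p n + countBelow (not ∘ p) n ≡ n
  countBelow-complement p zero = refl
  countBelow-complement p (suc n) with p 0
  ... | true  = cong suc (countBelow-complement (p ∘ suc) n)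
  ... | false = trans (ℕₚ.+-suc (countBelow (p ∘ suc) n) _) (cong suc (countBelow-complement (p ∘ suc) n))

  countBelow-none : ∀ {p : ℕ → Bool} n → (∀ i → p i ≡ false) → countBelow p n ≡ 0
  countBelow-none zero    p≡false = refl
  countBelow-none {p} (suc n) p≡false rewrite p≡false 0 = countBelow-none n (p≡false ∘ suc)

  unique-↭ : ∀ {xs ys : List A} → Unique xs → Unique ys → (∀ {z} → z ∈ xs → z ∈ ys) → (∀ {z} → z ∈ ys → z ∈ xs) → xs ↭ ys
  unique-↭ xs! ys! xs⊆ys ys⊆xs = ∼bag⇒↭ (unique∧set⇒bag xs! ys! (mk⇔ xs⊆ys ys⊆xs))

  map⁺-injectiveOn : ∀ {f : A → B} {xs} → Unique xs → (∀ {x y} → x ∈ xs → y ∈ xs → f x ≡ f y → x ≡ y) → Unique (map f xs)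
  map⁺-injectiveOn {xs = []} _ _ = []
  map⁺-injectiveOn {f = f} {xs = x ∷ xs} (x∉xs ∷ xs!) inj =
    All.tabulate (λ fy∈ fx≡fy → let (y , y∈xs , fy≡) = ∈ₚ.∈-map⁻ f fy∈ in
                   All.lookup x∉xs y∈xs (inj (here refl) (there y∈xs) (trans fx≡fy fy≡)))
    ∷ map⁺-injectiveOn xs! (λ x∈ y∈ → inj (there x∈) (there y∈))

  concatMap⁺-disjointFibres : ∀ {f : A → List B} {xs} → Unique xs → (∀ {x} → x ∈ xs → Unique (f x)) →
    (∀ {x x′ y} → x ∈ xs → x′ ∈ xs → y ∈ f x → y ∈ f x′ → x ≡ x′) → Unique (concatMap f xs)
  concatMap⁺-disjointFibres {xs = []} _ _ _ = []
  concatMap⁺-disjointFibres {f = f} {xs = x ∷ xs} (x∉xs ∷ xs!) f! fibres =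
    Uniqueₚ.++⁺ (f! (here refl)) (concatMap⁺-disjointFibres xs! (f! ∘ there) (λ p q → fibres (there p) (there q))) disjoint
    where
    disjoint : ∀ {y} → y ∈ f x × y ∈ concatMap f xs → ⊥
    disjoint (y∈fx , y∈rest) with ∈ₚ.∈-concatMap⁻ f {xs = xs} y∈rest
    ... | any = go xs x∉xs any (λ p q → fibres (here refl) (there p) y∈fx q)
      where
      open import Data.List.Relation.Unary.Any using (Any)
      go : ∀ {y} zs → All (x ≢_) zs → Any (λ z → y ∈ f z) zs → (∀ {x′} → x′ ∈ zs → y ∈ f x′ → x ≡ x′) → ⊥
      go (z ∷ zs) (x≢z ∷ _)   (here y∈fz)  same = x≢z (same (here refl) y∈fz)
      go (z ∷ zs) (_   ∷ x∉) (there y∈)   same = go zs x∉ y∈ (same ∘ there)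

module Avoidance where

  open import Defs using (all; avoidsPattern; _≤ᵇ'_; _⇒ᵇ_)
  open import Data.Bool using (Bool; true; false; _∧_; _∨_)
  open import Data.Nat using (ℕ; zero; suc; _<ᵇ_; _≡ᵇ_)
  open import Data.Fin using (Fin; toℕ) renaming (zero to fzero; suc to fsuc)
  open import Data.Vec using (Vec; []; _∷_; lookup; toList; tabulate; allFin)
  open import Data.List using (List; []; _∷_)
  open import Function using (_∘_; id)
  open import Relation.Binary.PropositionalEquality

  occursᵇ : ℕ → List ℕ → Bool
  occursᵇ x []       = false
  occursᵇ x (y ∷ ys) = (x ≡ᵇ y) ∨ occursᵇ x ys

  -- no letter smaller than x lies before an occurrence of x in ys
  avoidsAt : ℕ → List ℕ → Bool
  avoidsAt x []       = true
  avoidsAt x (y ∷ ys) = (occursᵇ x ys ⇒ᵇ (x ≤ᵇ' y)) ∧ avoidsAt x ys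

  avoids : List ℕ → Bool
  avoids []       = true
  avoids (x ∷ xs) = avoidsAt x xs ∧ avoids xs

  private
    everyFin someFin : ∀ {m} → (Fin m → Bool) → Bool
    everyFin {zero}  q = true
    everyFin {suc m} q = q fzero ∧ everyFin (q ∘ fsuc)
    someFin  {zero}  q = false
    someFin  {suc m} q = q fzero ∨ someFin (q ∘ fsuc)

    all-tabulate : ∀ {X : Set} {m} (p : X → Bool) (f : Fin m → X) → all p (toList (tabulate f)) ≡ everyFin (p ∘ f)
    all-tabulate {m = zero}  p f = refl
    all-tabulate {m = suc m} p f = cong (p (f fzero) ∧_) (all-tabulate p (f ∘ fsuc))

    everyFin-cong : ∀ {m} {q q′ : Fin m → Bool} → (∀ i → q i ≡ q′ i) → everyFin q ≡ everyFin q′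
    everyFin-cong {zero}  q≡q′ = refl
    everyFin-cong {suc m} q≡q′ = cong₂ _∧_ (q≡q′ fzero) (everyFin-cong (q≡q′ ∘ fsuc))

    everyFin-true : ∀ m → everyFin {m} (λ _ → true) ≡ true
    everyFin-true zero    = refl
    everyFin-true (suc m) = everyFin-true m

    everyFin-⇒ : ∀ {m} (b : Fin m → Bool) c → everyFin (λ k → b k ⇒ᵇ c) ≡ (someFin b ⇒ᵇ c)
    everyFin-⇒ {zero}  b c = refl
    everyFin-⇒ {suc m} b c with b fzero
    ... | false = everyFin-⇒ (b ∘ fsuc) c
    ... | true rewrite everyFin-⇒ (b ∘ fsuc) c with someFin (b ∘ fsuc) | c
    ...   | true  | true  = refl
    ...   | true  | false = refl
    ...   | false | true  = refl
    ...   | false | false = refl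

    someFin-occurs : ∀ {m} x (v : Vec ℕ m) → someFin (λ k → x ≡ᵇ lookup v k) ≡ occursᵇ x (toList v)
    someFin-occurs x []      = refl
    someFin-occurs x (y ∷ v) = cong ((x ≡ᵇ y) ∨_) (someFin-occurs x v)

    [b∧false]⇒c : ∀ b c → ((b ∧ false) ⇒ᵇ c) ≡ true
    [b∧false]⇒c true  c = refl
    [b∧false]⇒c false c = refl

    pattern-free : ∀ {m} → Vec ℕ m → Fin m → Fin m → Fin m → Bool
    pattern-free w i j k =
      ((toℕ i <ᵇ toℕ j) ∧ (toℕ j <ᵇ toℕ k) ∧ (lookup w i ≡ᵇ lookup w k)) ⇒ᵇ (lookup w i ≤ᵇ' lookup w j)

    avoidsᶠ : ∀ {m} → Vec ℕ m → Bool
    avoidsᶠ w = everyFin (λ i → everyFin (λ j → everyFin (λ k → pattern-free w i j k)))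

    avoidsAtᶠ : ∀ {m} → ℕ → Vec ℕ m → Bool
    avoidsAtᶠ x v = everyFin (λ j → everyFin (λ k → ((toℕ j <ᵇ toℕ k) ∧ (x ≡ᵇ lookup v k)) ⇒ᵇ (x ≤ᵇ' lookup v j)))

    avoidsPattern≡avoidsᶠ : ∀ {m} (w : Vec ℕ m) → avoidsPattern w ≡ avoidsᶠ w
    avoidsPattern≡avoidsᶠ {m} w =
      trans (all-tabulate {m = m} (λ i → all (λ j → all (λ k → pattern-free w i j k) positions) positions) id)
        (everyFin-cong (λ i → trans (all-tabulate {m = m} (λ j → all (λ k → pattern-free w i j k) positions) id)
          (everyFin-cong (λ j → all-tabulate {m = m} (λ k → pattern-free w i j k) id))))
      where positions = toList (allFin m)

    avoidsAtᶠ≡avoidsAt : ∀ {m} x (v : Vec ℕ m) → avoidsAtᶠ x v ≡ avoidsAt x (toList v)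
    avoidsAtᶠ≡avoidsAt x []      = refl
    avoidsAtᶠ≡avoidsAt x (y ∷ v) = cong₂ _∧_
      (trans (everyFin-⇒ (λ k → x ≡ᵇ lookup v k) (x ≤ᵇ' y)) (cong (_⇒ᵇ (x ≤ᵇ' y)) (someFin-occurs x v)))
      (avoidsAtᶠ≡avoidsAt x v)

    avoidsᶠ-∷ : ∀ {m} x (v : Vec ℕ m) → avoidsᶠ (x ∷ v) ≡ avoidsAtᶠ x v ∧ avoidsᶠ v
    avoidsᶠ-∷ {m} x v = cong₂ _∧_ (cong (_∧ avoidsAtᶠ x v) (everyFin-true (suc m))) (everyFin-cong later)
      where
      later : ∀ i → everyFin (λ j → everyFin (λ k → pattern-free (x ∷ v) (fsuc i) j k)) ≡
                    everyFin (λ j → everyFin (λ k → pattern-free v i j k))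
      later i = cong₂ _∧_ (everyFin-true (suc m)) (everyFin-cong (λ j →
        cong (_∧ everyFin (λ k → pattern-free v i j k)) ([b∧false]⇒c (toℕ i <ᵇ toℕ j) (lookup v i ≤ᵇ' lookup v j))))

    avoidsᶠ≡avoids : ∀ {m} (w : Vec ℕ m) → avoidsᶠ w ≡ avoids (toList w)
    avoidsᶠ≡avoids []      = refl
    avoidsᶠ≡avoids (x ∷ v) = trans (avoidsᶠ-∷ x v) (cong₂ _∧_ (avoidsAtᶠ≡avoidsAt x v) (avoidsᶠ≡avoids v))

  avoidsPattern≡avoids : ∀ {m} (w : Vec ℕ m) → avoidsPattern w ≡ avoids (toList w)
  avoidsPattern≡avoids w = trans (avoidsPattern≡avoidsᶠ w) (avoidsᶠ≡avoids w)

module NatBool where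

  open import Defs using (_⇒ᵇ_)
  open import Data.Bool using (true; false)
  open import Data.Nat using (zero; suc; _<_; _≤_; s≤s; _<ᵇ_; _≡ᵇ_)
  open import Data.Empty using (⊥-elim)
  open import Function using (_∘_)
  open import Relation.Binary.PropositionalEquality

  <ᵇ-true : ∀ {a b} → a < b → (a <ᵇ b) ≡ true
  <ᵇ-true {zero}  {suc b} _         = refl
  <ᵇ-true {suc a} {suc b} (s≤s a<b) = <ᵇ-true a<b

  <ᵇ-false : ∀ {a b} → b ≤ a → (a <ᵇ b) ≡ false
  <ᵇ-false {a}     {zero}  _         = refl
  <ᵇ-false {suc a} {suc b} (s≤s b≤a) = <ᵇ-false b≤a

  ≡ᵇ-refl : ∀ a → (a ≡ᵇ a) ≡ true
  ≡ᵇ-refl zero    = refl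
  ≡ᵇ-refl (suc a) = ≡ᵇ-refl a

  ≡ᵇ-false : ∀ {a b} → a ≢ b → (a ≡ᵇ b) ≡ false
  ≡ᵇ-false {zero}  {zero}  a≢b = ⊥-elim (a≢b refl)
  ≡ᵇ-false {zero}  {suc b} a≢b = refl
  ≡ᵇ-false {suc a} {zero}  a≢b = refl
  ≡ᵇ-false {suc a} {suc b} a≢b = ≡ᵇ-false (a≢b ∘ cong suc)

  ≡ᵇ-true⇒≡ : ∀ {a b} → (a ≡ᵇ b) ≡ true → a ≡ b
  ≡ᵇ-true⇒≡ {zero}  {zero}  _ = refl
  ≡ᵇ-true⇒≡ {suc a} {suc b} e = cong suc (≡ᵇ-true⇒≡ e)

  ≡ᵇ-false⇒≢ : ∀ {a b} → (a ≡ᵇ b) ≡ false → a ≢ b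
  ≡ᵇ-false⇒≢ {a} a≢ᵇb refl with trans (sym a≢ᵇb) (≡ᵇ-refl a)
  ... | ()

  ⇒ᵇ-true : ∀ b → (b ⇒ᵇ true) ≡ true
  ⇒ᵇ-true true  = refl
  ⇒ᵇ-true false = refl

  ≡ᵇ-sym : ∀ a b → (a ≡ᵇ b) ≡ (b ≡ᵇ a)
  ≡ᵇ-sym zero    zero    = refl
  ≡ᵇ-sym zero    (suc b) = refl
  ≡ᵇ-sym (suc a) zero    = refl
  ≡ᵇ-sym (suc a) (suc b) = ≡ᵇ-sym a b

module Occurrences where

  open import Data.Bool using (false)
  open import Data.Bool.Properties using (∨-conicalˡ; ∨-conicalʳ)
  open import Data.Nat as ℕ using (zero; suc; _+_)
  open import Data.List using (List; []; _∷_; _++_; length; replicate; filter)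
  import Data.List.Properties as Listₚ
  open import Relation.Binary.PropositionalEquality
  open Avoidance using (occursᵇ)
  open NatBool

  occurrences : ℕ → List ℕ → ℕ
  occurrences a u = length (filter (ℕ._≟ a) u)

  occurrences-++ : ∀ a xs ys → occurrences a (xs ++ ys) ≡ occurrences a xs + occurrences a ys
  occurrences-++ a xs ys = trans (cong length (Listₚ.filter-++ (ℕ._≟ a) xs ys)) (Listₚ.length-++ (filter (ℕ._≟ a) xs))

  occurrences-∷-self : ∀ a xs → occurrences a (a ∷ xs) ≡ suc (occurrences a xs)
  occurrences-∷-self a xs rewrite ≡ᵇ-refl a = refl

  occurrences-∷-other : ∀ {a x} xs → x ≢ a → occurrences a (x ∷ xs) ≡ occurrences a xs
  occurrences-∷-other xs x≢a rewrite ≡ᵇ-false x≢a = refl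

  occurrences-replicate-self : ∀ a k → occurrences a (replicate k a) ≡ k
  occurrences-replicate-self a zero    = refl
  occurrences-replicate-self a (suc k) = trans (occurrences-∷-self a _) (cong suc (occurrences-replicate-self a k))

  occurrences-absent : ∀ a xs → occursᵇ a xs ≡ false → occurrences a xs ≡ 0
  occurrences-absent a []       _ = refl
  occurrences-absent a (y ∷ ys) a∉ rewrite ≡ᵇ-false {y} {a} (λ y≡a → ≡ᵇ-false⇒≢ (∨-conicalˡ _ _ a∉) (sym y≡a)) =
    occurrences-absent a ys (∨-conicalʳ _ _ a∉)


module Insertion (s v : ℕ) where

  open import Defs using (des; _≤ᵇ'_; _⇒ᵇ_)
  open Avoidance using (occursᵇ; avoidsAt; avoids)
  open ListCounting using (indicator; countBelow)
  open NatBool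
  open Occurrences
  open import Data.Bool using (Bool; true; false; _∧_; _∨_; not; if_then_else_)
  open import Data.Bool.Properties using (∧-conicalˡ; ∧-conicalʳ; ∨-conicalˡ; ∨-conicalʳ; ∧-assoc; ∧-comm; ∧-idem)
  open import Data.Nat as ℕ using (ℕ; zero; suc; _+_; _<_; _≤_; s≤s; _<ᵇ_; _≡ᵇ_)
  import Data.Nat.Properties as ℕₚ
  open import Data.List using (List; []; _∷_; _++_; take; drop; length; replicate)
  import Data.List.Properties as Listₚ
  open import Data.List.Relation.Unary.All using (All; []; _∷_)
  open import Data.Product using (Σ; _×_; _,_; proj₁; proj₂)
  open import Relation.Binary.PropositionalEquality
  open import Relation.Nullary using (yes; no)
  open import Function using (_∘_)
  open ≡-Reasoning

  r : ℕ
  r = suc s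

  block : List ℕ
  block = replicate r v

  insertBlock : List ℕ → ℕ → List ℕ
  insertBlock u g = take g u ++ block ++ drop g u

  insertBlock-additive : (f : List ℕ → ℕ) → (∀ xs ys → f (xs ++ ys) ≡ f xs + f ys) →
                         ∀ u g → f (insertBlock u g) ≡ f block + f u
  insertBlock-additive f f-++ u g = begin
    f (take g u ++ block ++ drop g u)               ≡⟨ f-++ (take g u) _ ⟩
    f (take g u) + f (block ++ drop g u)            ≡⟨ cong (f (take g u) +_) (f-++ block (drop g u)) ⟩
    f (take g u) + (f block + f (drop g u))         ≡⟨ +-exchange (f (take g u)) (f block) _ ⟩
    f block + (f (take g u) + f (drop g u))         ≡⟨ cong (f block +_) (f-++ (take g u) (drop g u)) ⟨
    f block + f (take g u ++ drop g u)              ≡⟨ cong (λ w → f block + f w) (Listₚ.take++drop≡id g u) ⟩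
    f block + f u                                   ∎
    where
    +-exchange : ∀ a b c → a + (b + c) ≡ b + (a + c)
    +-exchange a b c = trans (sym (ℕₚ.+-assoc a b c)) (trans (cong (_+ c) (ℕₚ.+-comm a b)) (ℕₚ.+-assoc b a c))

  length-insertBlock : ∀ u g → length (insertBlock u g) ≡ r + length u
  length-insertBlock u g = trans (insertBlock-additive length (λ xs ys → Listₚ.length-++ xs) u g)
                                 (cong (_+ length u) (Listₚ.length-replicate r))

  occurrences-block-other : ∀ a → a ≢ v → occurrences a block ≡ 0
  occurrences-block-other a a≢v = go r
    where
    go : ∀ k → occurrences a (replicate k v) ≡ 0
    go zero    = refl
    go (suc k) rewrite ≡ᵇ-false {v} {a} (a≢v ∘ sym) = go k

  occurrences-insertBlock : ∀ a u g → occurrences a (insertBlock u g) ≡ occurrences a block + occurrences a u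
  occurrences-insertBlock a = insertBlock-additive (occurrences a) (occurrences-++ a)

  occursᵇ-insertBlock : ∀ a → (a ≡ᵇ v) ≡ false → ∀ as bs → occursᵇ a (as ++ block ++ bs) ≡ occursᵇ a (as ++ bs)
  occursᵇ-insertBlock a a≢v [] bs = go r
    where
    go : ∀ k → occursᵇ a (replicate k v ++ bs) ≡ occursᵇ a bs
    go zero    = refl
    go (suc k) rewrite a≢v = go k
  occursᵇ-insertBlock a a≢v (x ∷ as) bs = cong ((a ≡ᵇ x) ∨_) (occursᵇ-insertBlock a a≢v as bs)

  avoidsAt-insertBlock : ∀ a → a < v → ∀ as bs → avoidsAt a (as ++ block ++ bs) ≡ avoidsAt a (as ++ bs)
  avoidsAt-insertBlock a a<v [] bs = go r
    where
    go : ∀ k → avoidsAt a (replicate k v ++ bs) ≡ avoidsAt a bs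
    go zero    = refl
    go (suc k) rewrite <ᵇ-true {a} {suc v} (s≤s (ℕₚ.<⇒≤ a<v)) | ⇒ᵇ-true (occursᵇ a (replicate k v ++ bs)) = go k
  avoidsAt-insertBlock a a<v (x ∷ as) bs =
    cong₂ _∧_ (cong (_⇒ᵇ (a ≤ᵇ' x)) (occursᵇ-insertBlock a (≡ᵇ-false (ℕₚ.<⇒≢ a<v)) as bs)) (avoidsAt-insertBlock a a<v as bs)

  avoids-suffix : ∀ xs bs → avoids (xs ++ bs) ≡ avoids bs ∧ avoids (xs ++ bs)
  avoids-suffix []       bs = sym (∧-idem (avoids bs))
  avoids-suffix (x ∷ xs) bs = begin
    avoidsAt x (xs ++ bs) ∧ avoids (xs ++ bs)                  ≡⟨ cong (avoidsAt x (xs ++ bs) ∧_) (avoids-suffix xs bs) ⟩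
    avoidsAt x (xs ++ bs) ∧ (avoids bs ∧ avoids (xs ++ bs))    ≡⟨ ∧-assoc (avoidsAt x (xs ++ bs)) _ _ ⟨
    (avoidsAt x (xs ++ bs) ∧ avoids bs) ∧ avoids (xs ++ bs)    ≡⟨ cong (_∧ avoids (xs ++ bs)) (∧-comm (avoidsAt x (xs ++ bs)) _) ⟩
    (avoids bs ∧ avoidsAt x (xs ++ bs)) ∧ avoids (xs ++ bs)    ≡⟨ ∧-assoc (avoids bs) _ _ ⟩
    avoids bs ∧ (avoidsAt x (xs ++ bs) ∧ avoids (xs ++ bs))    ∎

  avoids-insertBlock : ∀ as bs → All (_< v) as → avoids (as ++ block ++ bs) ≡ avoids (as ++ bs) ∧ avoids (block ++ bs)
  avoids-insertBlock []       bs []           = avoids-suffix block bs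
  avoids-insertBlock (x ∷ as) bs (x<v ∷ as<v) = begin
    avoidsAt x (as ++ block ++ bs) ∧ avoids (as ++ block ++ bs)
      ≡⟨ cong₂ _∧_ (avoidsAt-insertBlock x x<v as bs) (avoids-insertBlock as bs as<v) ⟩
    avoidsAt x (as ++ bs) ∧ (avoids (as ++ bs) ∧ avoids (block ++ bs))
      ≡⟨ ∧-assoc (avoidsAt x (as ++ bs)) _ _ ⟨
    (avoidsAt x (as ++ bs) ∧ avoids (as ++ bs)) ∧ avoids (block ++ bs) ∎

  avoidsAt-absent : ∀ a bs → occursᵇ a bs ≡ false → avoidsAt a bs ≡ true
  avoidsAt-absent a []       _   = refl
  avoidsAt-absent a (y ∷ ys) a∉ rewrite ∨-conicalʳ (a ≡ᵇ y) (occursᵇ a ys) a∉ = avoidsAt-absent a ys (∨-conicalʳ _ _ a∉)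

  avoids-block : ∀ bs → occursᵇ v bs ≡ false → avoids bs ≡ true → avoids (block ++ bs) ≡ true
  avoids-block bs v∉bs bs-avoids = go r
    where
    avoidsAt-v : ∀ k → avoidsAt v (replicate k v ++ bs) ≡ true
    avoidsAt-v zero    = avoidsAt-absent v bs v∉bs
    avoidsAt-v (suc k) rewrite <ᵇ-true {v} {suc v} (ℕₚ.n<1+n v) | ⇒ᵇ-true (occursᵇ v (replicate k v ++ bs)) = avoidsAt-v k
    go : ∀ k → avoids (replicate k v ++ bs) ≡ true
    go zero    = bs-avoids
    go (suc k) rewrite avoidsAt-v k = go k

  -- inserting at gap g of u creates no new descent exactly when g follows a descent of u or is the last gap
  descentGap : List ℕ → ℕ → Bool
  descentGap []           g             = false
  descentGap (x ∷ xs)     zero          = false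
  descentGap (x ∷ [])     (suc g)       = true
  descentGap (x ∷ y ∷ ys) (suc zero)    = y <ᵇ x
  descentGap (x ∷ y ∷ ys) (suc (suc g)) = descentGap (y ∷ ys) (suc g)

  private
    v<ᵇv : (v <ᵇ v) ≡ false
    v<ᵇv = <ᵇ-false {v} {v} ℕₚ.≤-refl

    des-block : des block ≡ 1
    des-block = go s
      where
      go : ∀ k → des (replicate (suc k) v) ≡ 1
      go zero    = refl
      go (suc k) rewrite v<ᵇv = go k

    des-block-++ : ∀ y ys → y < v → des (block ++ y ∷ ys) ≡ suc (des (y ∷ ys))
    des-block-++ y ys y<v = go s
      where
      go : ∀ k → des (replicate (suc k) v ++ y ∷ ys) ≡ suc (des (y ∷ ys))
      go zero    rewrite <ᵇ-true y<v = refl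
      go (suc k) rewrite v<ᵇv = go k

    if≡indicator : ∀ b → (if b then 1 else 0) ≡ indicator b
    if≡indicator true  = refl
    if≡indicator false = refl

    insertBlock-[] : ∀ g → insertBlock [] g ≡ block
    insertBlock-[] g rewrite Listₚ.take-[] {A = ℕ} g | Listₚ.drop-[] {A = ℕ} g = Listₚ.++-identityʳ block

  des-insertBlock : ∀ u g → All (_< v) u → des (insertBlock u g) ≡ des u + indicator (not (descentGap u g))
  des-insertBlock []           g             _ rewrite insertBlock-[] g = des-block
  des-insertBlock (x ∷ xs)     zero          (x<v ∷ _) = trans (des-block-++ x xs x<v) (ℕₚ.+-comm 1 (des (x ∷ xs)))
  des-insertBlock (x ∷ [])     (suc g)       (x<v ∷ _)
    rewrite Listₚ.take-[] {A = ℕ} g | Listₚ.drop-[] {A = ℕ} g | Listₚ.++-identityʳ block | <ᵇ-false {v} {x} (ℕₚ.<⇒≤ x<v) = des-block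
  des-insertBlock (x ∷ y ∷ ys) (suc zero)    (x<v ∷ y<v ∷ _)
    rewrite <ᵇ-false {v} {x} (ℕₚ.<⇒≤ x<v) | des-block-++ y ys y<v with y <ᵇ x
  ... | true  = sym (ℕₚ.+-identityʳ (suc (des (y ∷ ys))))
  ... | false = ℕₚ.+-comm 1 (des (y ∷ ys))
  des-insertBlock (x ∷ y ∷ ys) (suc (suc g)) (x<v ∷ ys<v) =
    trans (cong ((if y <ᵇ x then 1 else 0) +_) (des-insertBlock (y ∷ ys) (suc g) ys<v))
          (sym (ℕₚ.+-assoc (if y <ᵇ x then 1 else 0) _ _))

  countBelow-descentGap : ∀ u → countBelow (descentGap u) (suc (length u)) ≡ des u
  countBelow-descentGap []           = refl
  countBelow-descentGap (x ∷ [])     = refl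
  countBelow-descentGap (x ∷ y ∷ ys) =
    trans (cong (indicator (y <ᵇ x) +_) (countBelow-descentGap (y ∷ ys))) (cong (_+ des (y ∷ ys)) (sym (if≡indicator (y <ᵇ x))))

  private
    -- when v is the largest letter, everything after the first v up to the last v is v
    leading-block : ∀ xs → avoidsAt v xs ≡ true → All (_≤ v) xs →
                    Σ ℕ λ j → Σ (List ℕ) λ bs → xs ≡ replicate j v ++ bs × occursᵇ v bs ≡ false
    leading-block []       _       _ = 0 , [] , refl , refl
    leading-block (y ∷ ys) avoidsY (y≤v ∷ ys≤v) with y ℕ.≟ v
    ... | yes refl with leading-block ys (∧-conicalʳ _ _ avoidsY) ys≤v
    ...   | j , bs , ys≡ , v∉bs = suc j , bs , cong (y ∷_) ys≡ , v∉bs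
    leading-block (y ∷ ys) avoidsY (y≤v ∷ ys≤v) | no y≢v = 0 , y ∷ ys , refl , v∉
      where
      ⇒ᵇ-false : ∀ b → (b ⇒ᵇ false) ≡ true → b ≡ false
      ⇒ᵇ-false false _ = refl
      v∉ : occursᵇ v (y ∷ ys) ≡ false
      v∉ rewrite ≡ᵇ-false {v} {y} (y≢v ∘ sym) =
        ⇒ᵇ-false (occursᵇ v ys) (subst (λ c → (occursᵇ v ys ⇒ᵇ c) ≡ true) (<ᵇ-false {v} {suc y} (ℕₚ.≤∧≢⇒< y≤v y≢v))
                                        (∧-conicalˡ _ _ avoidsY))

  occursᵇ-∷ : ∀ {x} xs → x ≢ v → occursᵇ v xs ≡ false → occursᵇ v (x ∷ xs) ≡ false
  occursᵇ-∷ xs x≢v v∉xs rewrite ≡ᵇ-false (x≢v ∘ sym) = v∉xs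

  split-at-block : ∀ xs → avoids xs ≡ true → All (_≤ v) xs → occurrences v xs ≡ r →
    Σ (List ℕ) λ as → Σ (List ℕ) λ bs → xs ≡ as ++ block ++ bs × occursᵇ v as ≡ false × occursᵇ v bs ≡ false
  split-at-block []       _       _              ()
  split-at-block (x ∷ xs) avoidsX (x≤v ∷ xs≤v) #v with x ℕ.≟ v
  ... | yes refl = [] , bs , cong (x ∷_) (trans xs≡ (cong (λ k → replicate k x ++ bs) j≡s)) , refl , v∉bs
    where
    open Σ (leading-block xs (∧-conicalˡ _ _ avoidsX) xs≤v) renaming (proj₁ to j; proj₂ to rest)
    bs = proj₁ rest
    xs≡ = proj₁ (proj₂ rest)
    v∉bs = proj₂ (proj₂ rest)
    j≡s : j ≡ s
    j≡s = ℕₚ.suc-injective (begin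
      suc j                                                ≡⟨ cong suc (sym (ℕₚ.+-identityʳ j)) ⟩
      suc (j + 0)                                          ≡⟨ cong (λ n → suc (n + 0)) (occurrences-replicate-self x j) ⟨
      suc (occurrences x (replicate j x) + 0)              ≡⟨ cong (λ n → suc (occurrences x (replicate j x) + n)) (occurrences-absent x bs v∉bs) ⟨
      suc (occurrences x (replicate j x) + occurrences x bs) ≡⟨ cong suc (occurrences-++ x (replicate j x) bs) ⟨
      suc (occurrences x (replicate j x ++ bs))            ≡⟨ cong (suc ∘ occurrences x) xs≡ ⟨
      suc (occurrences x xs)                               ≡⟨ occurrences-∷-self x xs ⟨
      occurrences x (x ∷ xs)                               ≡⟨ #v ⟩
      r                                                    ∎)
  ... | no x≢v with split-at-block xs (∧-conicalʳ _ _ avoidsX) xs≤v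
                      (trans (sym (occurrences-∷-other xs x≢v)) #v)
  ...   | as , bs , xs≡ , v∉as , v∉bs = x ∷ as , bs , cong (x ∷_) xs≡ , occursᵇ-∷ as x≢v v∉as , v∉bs

  private
    delete : List ℕ → List ℕ
    delete []       = []
    delete (x ∷ xs) = if x ≡ᵇ v then delete xs else x ∷ delete xs

    firstIndex : List ℕ → ℕ
    firstIndex []       = 0
    firstIndex (x ∷ xs) = if x ≡ᵇ v then 0 else suc (firstIndex xs)

    delete-absent : ∀ u → occursᵇ v u ≡ false → delete u ≡ u
    delete-absent []      _  = refl
    delete-absent (x ∷ u) v∉ rewrite trans (≡ᵇ-sym x v) (∨-conicalˡ _ _ v∉) = cong (x ∷_) (delete-absent u (∨-conicalʳ _ _ v∉))

    delete-replicate : ∀ k bs → delete (replicate k v ++ bs) ≡ delete bs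
    delete-replicate zero    bs = refl
    delete-replicate (suc k) bs rewrite ≡ᵇ-refl v = delete-replicate k bs

    delete-insertBlock : ∀ u g → occursᵇ v u ≡ false → delete (insertBlock u g) ≡ u
    delete-insertBlock u       zero    v∉ = trans (delete-replicate r u) (delete-absent u v∉)
    delete-insertBlock []      (suc g) v∉ = trans (cong delete (trans (insertBlock-[] (suc g)) (sym (Listₚ.++-identityʳ block)))) (delete-replicate r [])
    delete-insertBlock (x ∷ u) (suc g) v∉ rewrite trans (≡ᵇ-sym x v) (∨-conicalˡ _ _ v∉) =
      cong (x ∷_) (delete-insertBlock u g (∨-conicalʳ _ _ v∉))

    firstIndex-insertBlock : ∀ u g → occursᵇ v u ≡ false → g ≤ length u → firstIndex (insertBlock u g) ≡ g
    firstIndex-insertBlock u       zero    v∉ _ rewrite ≡ᵇ-refl v = refl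
    firstIndex-insertBlock (x ∷ u) (suc g) v∉ (s≤s g≤) rewrite trans (≡ᵇ-sym x v) (∨-conicalˡ _ _ v∉) =
      cong suc (firstIndex-insertBlock u g (∨-conicalʳ _ _ v∉) g≤)

  insertBlock-injective : ∀ {u u′ g g′} → occursᵇ v u ≡ false → occursᵇ v u′ ≡ false → g ≤ length u → g′ ≤ length u′ →
                          insertBlock u g ≡ insertBlock u′ g′ → u ≡ u′ × g ≡ g′
  insertBlock-injective {u} {u′} {g} {g′} v∉u v∉u′ g≤ g′≤ same =
    trans (sym (delete-insertBlock u g v∉u)) (trans (cong delete same) (delete-insertBlock u′ g′ v∉u′)) ,
    trans (sym (firstIndex-insertBlock u g v∉u g≤)) (trans (cong firstIndex same) (firstIndex-insertBlock u′ g′ v∉u′ g′≤))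

module Words where

  open import Defs using (values; words)
  open import Data.Nat using (zero; suc; _<_; _≤_; z≤n; s≤s)
  import Data.Nat.Properties as ℕₚ
  open import Data.List as List using (List; []; _∷_; length)
  open import Data.List.Membership.Propositional using (_∈_; find)
  import Data.List.Membership.Propositional.Properties as ∈ₚ
  open import Data.List.Relation.Unary.Any as Any using (here)
  open import Data.List.Relation.Unary.All using (All; []; _∷_)
  open import Data.List.Relation.Unary.Unique.Propositional using (Unique)
  import Data.List.Relation.Unary.Unique.Propositional.Properties as Uniqueₚ
  open import Data.List.Relation.Unary.AllPairs using ([]; _∷_)
  open import Data.Vec using (Vec; []; _∷_; toList)
  import Data.Vec.Properties as Vecₚ
  open import Data.Product using (Σ; _×_; _,_)
  open import Relation.Binary.PropositionalEquality
  open ListCounting using (map⁺-injectiveOn; concatMap⁺-disjointFibres)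

  ∈-values⁻ : ∀ {m x} → x ∈ values m → 0 < x × x ≤ m
  ∈-values⁻ x∈ with ∈ₚ.∈-map⁻ suc x∈
  ... | y , y∈ , refl = s≤s z≤n , ∈ₚ.∈-upTo⁻ y∈

  ∈-values⁺ : ∀ {m x} → 0 < x → x ≤ m → x ∈ values m
  ∈-values⁺ {x = suc y} _ y<m = ∈ₚ.∈-map⁺ suc (∈ₚ.∈-upTo⁺ y<m)

  values-unique : ∀ m → Unique (values m)
  values-unique m = Uniqueₚ.map⁺ ℕₚ.suc-injective (Uniqueₚ.upTo⁺ m)

  private
    extend : ∀ {k} → ℕ → Vec ℕ k → List (Vec ℕ (suc k))
    extend m w = List.map (_∷ w) (values m)

    ∈-words-∷⁻ : ∀ m k a (w : Vec ℕ k) → (a ∷ w) ∈ words m (suc k) → w ∈ words m k × a ∈ values m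
    ∈-words-∷⁻ m k a w aw∈ with find (∈ₚ.∈-concatMap⁻ (extend m) {xs = words m k} aw∈)
    ... | w′ , w′∈ , aw∈ext with ∈ₚ.∈-map⁻ (_∷ w′) aw∈ext
    ... | b , b∈ , aw≡ with Vecₚ.∷-injective aw≡
    ... | refl , refl = w′∈ , b∈

  ∈-words⁻ : ∀ m k (w : Vec ℕ k) → w ∈ words m k → All (_∈ values m) (toList w)
  ∈-words⁻ m zero    []      _  = []
  ∈-words⁻ m (suc k) (a ∷ w) w∈ with ∈-words-∷⁻ m k a w w∈
  ... | w∈′ , a∈ = a∈ ∷ ∈-words⁻ m k w w∈′

  ∈-words⁺ : ∀ m k (u : List ℕ) → length u ≡ k → All (_∈ values m) u → Σ (Vec ℕ k) λ w → w ∈ words m k × toList w ≡ u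
  ∈-words⁺ m zero    []      refl []           = [] , here refl , refl
  ∈-words⁺ m (suc k) (x ∷ u) refl (x∈ ∷ u∈) with ∈-words⁺ m k u refl u∈
  ... | w , w∈ , w≡u = x ∷ w , ∈ₚ.∈-concatMap⁺ (extend m) (Any.map (λ { refl → ∈ₚ.∈-map⁺ (_∷ w) x∈ }) w∈) , cong (x ∷_) w≡u

  words-unique : ∀ m k → Unique (words m k)
  words-unique m zero    = [] ∷ []
  words-unique m (suc k) = concatMap⁺-disjointFibres (words-unique m k)
    (λ _ → map⁺-injectiveOn (values-unique m) (λ _ _ → Vecₚ.∷-injectiveˡ))
    (λ _ _ → same-fibre)
    where
    same-fibre : ∀ {w w′ y} → y ∈ extend m w → y ∈ extend m w′ → w ≡ w′
    same-fibre y∈ y∈′ with ∈ₚ.∈-map⁻ _ y∈ | ∈ₚ.∈-map⁻ _ y∈′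
    ... | _ , _ , refl | _ , _ , eq = Vecₚ.∷-injectiveʳ eq

  toList-injective : ∀ {k} (xs ys : Vec ℕ k) → toList xs ≡ toList ys → xs ≡ ys
  toList-injective []       []       _  = refl
  toList-injective (x ∷ xs) (y ∷ ys) eq = cong₂ _∷_ (Listₚ.∷-injectiveˡ eq) (toList-injective xs ys (Listₚ.∷-injectiveʳ eq))
    where import Data.List.Properties as Listₚ

module RPermutations (s : ℕ) where

  open import Defs using (all; values; Q; hasMultiplicities; avoidsPattern; coeffA; des)
  open import Data.Bool using (Bool; true; _∧_; T)
  open import Data.Bool.Properties using (T?; T-≡; T-∧)
  open import Data.Nat using (suc; _*_; _≡ᵇ_)
  open import Data.List as List using (List; length)
  open import Data.List.Membership.Propositional using (_∈_)
  import Data.List.Membership.Propositional.Properties as ∈ₚ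
  open import Data.List.Relation.Unary.All using (All)
  open import Data.List.Relation.Unary.Unique.Propositional using (Unique)
  import Data.List.Relation.Unary.Unique.Propositional.Properties as Uniqueₚ
  open import Data.Vec using (Vec; toList)
  import Data.Vec.Properties as Vecₚ
  open import Data.Product using (_×_; _,_)
  open import Relation.Nullary using (Dec)
  open import Function using (Equivalence)
  open import Relation.Binary.PropositionalEquality
  open Equivalence using (to; from)
  open ListCounting using (count; count-map)
  open Avoidance using (avoids; avoidsPattern≡avoids)
  open Occurrences using (occurrences)
  open Words

  r : ℕ
  r = suc s

  hasMultiplicitiesₗ : ℕ → List ℕ → Bool
  hasMultiplicitiesₗ m u = all (λ a → occurrences a u ≡ᵇ r) (values m)

  IsRPermutation : ℕ → List ℕ → Set
  IsRPermutation m u = length u ≡ m * r × All (_∈ values m) u × hasMultiplicitiesₗ m u ≡ true × avoids u ≡ true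

  private
    Q-test : ∀ m (w : Vec ℕ (m * r)) → Dec (T (hasMultiplicities m r w ∧ avoidsPattern w))
    Q-test m w = T? (hasMultiplicities m r w ∧ avoidsPattern w)

  opaque
    𝒬 : ℕ → List (List ℕ)
    𝒬 m = List.map toList (Q m r)

    ∈-𝒬⁻ : ∀ {m u} → u ∈ 𝒬 m → IsRPermutation m u
    ∈-𝒬⁻ {m} u∈ with ∈ₚ.∈-map⁻ toList u∈
    ... | w , w∈Q , refl with ∈ₚ.∈-filter⁻ (Q-test m) {xs = Defs.words m (m * r)} w∈Q
    ... | w∈words , test with to T-∧ test
    ... | mult , avoid = Vecₚ.length-toList w , ∈-words⁻ m (m * r) w w∈words , to T-≡ mult ,
                         trans (sym (avoidsPattern≡avoids w)) (to T-≡ avoid)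

    ∈-𝒬⁺ : ∀ {m u} → IsRPermutation m u → u ∈ 𝒬 m
    ∈-𝒬⁺ {m} {u} (len , letters , mult , avoid) with ∈-words⁺ m (m * r) u len letters
    ... | w , w∈words , refl = ∈ₚ.∈-map⁺ toList (∈ₚ.∈-filter⁺ (Q-test m) w∈words
            (from T-∧ (from T-≡ mult , from T-≡ (trans (avoidsPattern≡avoids w) avoid))))

    𝒬-unique : ∀ m → Unique (𝒬 m)
    𝒬-unique m = Uniqueₚ.map⁺ (toList-injective _ _) (Uniqueₚ.filter⁺ (Q-test m) (words-unique m (m * r)))

    coeffA≡count : ∀ m k → coeffA r m k ≡ count (λ u → des u ≡ᵇ k) (𝒬 m)
    coeffA≡count m k = sym (count-map (λ u → des u ≡ᵇ k) toList (Q m r))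

module GapCounting where

  open import Data.Bool using (Bool; true; false; not)
  open import Data.Nat using (suc; _+_; _*_; _≡ᵇ_; _≟_)
  import Data.Nat.Properties as ℕₚ
  open import Function using (_∘_)
  open import Relation.Binary.PropositionalEquality
  open import Relation.Nullary using (yes; no)
  open import Data.Nat.Solver using (module +-*-Solver)
  open +-*-Solver
  open ListCounting using (indicator; countBelow; countBelow-cong; countBelow-complement; countBelow-none)
  open NatBool using (≡ᵇ-refl; ≡ᵇ-false)

  -- L + 1 gaps, d of which are marked by b; a gap g contributes d + 1 unless it is marked
  gap-count : ∀ (d L : ℕ) (b : ℕ → Bool) → countBelow b (suc L) ≡ d → ∀ j →
    countBelow (λ g → (d + indicator (not (b g))) ≡ᵇ suc j) (suc L) + j * indicator (d ≡ᵇ j) ≡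
    suc j * indicator (d ≡ᵇ suc j) + (L * indicator (d ≡ᵇ j) + indicator (d ≡ᵇ j))
  gap-count d L b #b≡d j with d ≟ suc j
  ... | yes refl rewrite ≡ᵇ-refl j | ≡ᵇ-false {suc j} {j} ℕₚ.1+n≢n = begin
      countBelow (λ g → (suc j + indicator (not (b g))) ≡ᵇ suc j) (suc L) + j * 0
        ≡⟨ cong₂ _+_ (trans (countBelow-cong (suc L) marked) #b≡d) (ℕₚ.*-zeroʳ j) ⟩
      suc j + 0
        ≡⟨ solve 2 (λ j L → j :+ con 0 := j :* con 1 :+ (L :* con 0 :+ con 0)) refl (suc j) L ⟩
      suc j * 1 + (L * 0 + 0) ∎
    where
    open ≡-Reasoning
    marked : ∀ g → ((suc j + indicator (not (b g))) ≡ᵇ suc j) ≡ b g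
    marked g with b g
    ... | true  rewrite ℕₚ.+-identityʳ j = ≡ᵇ-refl j
    ... | false rewrite ℕₚ.+-comm j 1    = ≡ᵇ-false {suc j} {j} ℕₚ.1+n≢n
  ... | no d≢1+j with d ≟ j
  ...   | yes refl rewrite ≡ᵇ-refl d | ≡ᵇ-false {d} {suc d} d≢1+j = begin
      countBelow (λ g → (d + indicator (not (b g))) ≡ᵇ suc d) (suc L) + d * 1
        ≡⟨ cong₂ _+_ (countBelow-cong (suc L) unmarked) (ℕₚ.*-identityʳ d) ⟩
      countBelow (not ∘ b) (suc L) + d
        ≡⟨ ℕₚ.+-comm (countBelow (not ∘ b) (suc L)) d ⟩
      d + countBelow (not ∘ b) (suc L)
        ≡⟨ cong (_+ countBelow (not ∘ b) (suc L)) #b≡d ⟨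
      countBelow b (suc L) + countBelow (not ∘ b) (suc L)
        ≡⟨ countBelow-complement b (suc L) ⟩
      suc L
        ≡⟨ solve 2 (λ d L → con 1 :+ L := d :* con 0 :+ (L :* con 1 :+ con 1)) refl (suc d) L ⟩
      suc d * 0 + (L * 1 + 1) ∎
    where
    open ≡-Reasoning
    unmarked : ∀ g → ((d + indicator (not (b g))) ≡ᵇ suc d) ≡ not (b g)
    unmarked g with b g
    ... | true  rewrite ℕₚ.+-identityʳ d = ≡ᵇ-false {d} {suc d} d≢1+j
    ... | false rewrite ℕₚ.+-comm d 1    = ≡ᵇ-refl d
  ...   | no d≢j rewrite ≡ᵇ-false d≢1+j | ≡ᵇ-false d≢j = begin
      countBelow (λ g → (d + indicator (not (b g))) ≡ᵇ suc j) (suc L) + j * 0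
        ≡⟨ cong₂ _+_ (countBelow-none (suc L) never) (ℕₚ.*-zeroʳ j) ⟩
      0
        ≡⟨ solve 2 (λ j L → con 0 := j :* con 0 :+ (L :* con 0 :+ con 0)) refl (suc j) L ⟩
      suc j * 0 + (L * 0 + 0) ∎
    where
    open ≡-Reasoning
    never : ∀ g → ((d + indicator (not (b g))) ≡ᵇ suc j) ≡ false
    never g with b g
    ... | true  rewrite ℕₚ.+-identityʳ d = ≡ᵇ-false d≢1+j
    ... | false rewrite ℕₚ.+-comm d 1    = ≡ᵇ-false {suc d} {suc j} (d≢j ∘ ℕₚ.suc-injective)

module CountingInsertions (s n : ℕ) where

  open import Defs using (all; values; coeffA; des)
  open import Data.Bool using (Bool; true; false; _∧_)
  open import Data.Bool.Properties using (∧-conicalˡ; ∧-conicalʳ; ∨-conicalˡ; ∨-conicalʳ)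
  open import Data.Nat as ℕ using (suc; _+_; _*_; _<_; _≤_; z≤n; s≤s; _≡ᵇ_)
  import Data.Nat.Properties as ℕₚ
  open import Data.List as List using (List; []; _∷_; _++_; length; concatMap; upTo; take; drop; replicate)
  import Data.List.Properties as Listₚ
  open import Data.List.Membership.Propositional using (_∈_; find)
  import Data.List.Membership.Propositional.Properties as ∈ₚ
  open import Data.List.Relation.Unary.Any as Any using (here; there)
  open import Data.List.Relation.Unary.All as All using (All; []; _∷_)
  import Data.List.Relation.Unary.All.Properties as Allₚ
  open import Data.List.Relation.Unary.Unique.Propositional using (Unique)
  import Data.List.Relation.Unary.Unique.Propositional.Properties as Uniqueₚ
  open import Data.List.Relation.Binary.Permutation.Propositional using (_↭_)
  open import Data.Product using (Σ; _×_; _,_; proj₁; proj₂)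
  open import Data.Sum using (inj₁; inj₂)
  open import Function using (_∘_; id)
  open import Relation.Binary.PropositionalEquality
  open import Relation.Nullary using (yes; no)
  open ListCounting
  open NatBool
  open Avoidance using (occursᵇ; avoids)
  open Occurrences
  open Words using (∈-values⁻; ∈-values⁺)
  open RPermutations s
  open Insertion s (suc n) hiding (r)
  open GapCounting

  v L : ℕ
  v = suc n
  L = n * r

  gaps : List ℕ
  gaps = upTo (suc L)

  private
    all-true⁻ : ∀ {A : Set} (p : A → Bool) xs → all p xs ≡ true → ∀ {x} → x ∈ xs → p x ≡ true
    all-true⁻ p (y ∷ ys) all-p (here refl) = ∧-conicalˡ _ _ all-p
    all-true⁻ p (y ∷ ys) all-p (there x∈)  = all-true⁻ p ys (∧-conicalʳ _ _ all-p) x∈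

    all-true⁺ : ∀ {A : Set} (p : A → Bool) xs → (∀ {x} → x ∈ xs → p x ≡ true) → all p xs ≡ true
    all-true⁺ p []       p-true = refl
    all-true⁺ p (y ∷ ys) p-true rewrite p-true (here refl) = all-true⁺ p ys (p-true ∘ there)

    take-length-++ : ∀ (as bs : List ℕ) → take (length as) (as ++ bs) ≡ as
    take-length-++ []       bs = refl
    take-length-++ (a ∷ as) bs = cong (a ∷_) (take-length-++ as bs)

    drop-length-++ : ∀ (as bs : List ℕ) → drop (length as) (as ++ bs) ≡ bs
    drop-length-++ []       bs = refl
    drop-length-++ (a ∷ as) bs = drop-length-++ as bs

    <v : ∀ {x} → x ∈ values n → x < v
    <v x∈ = s≤s (proj₂ (∈-values⁻ x∈))

    ∈-values-suc : ∀ {x} → x ∈ values n → x ∈ values v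
    ∈-values-suc x∈ = ∈-values⁺ (proj₁ (∈-values⁻ x∈)) (ℕₚ.m≤n⇒m≤1+n (proj₂ (∈-values⁻ x∈)))

    v∈values : v ∈ values v
    v∈values = ∈-values⁺ (s≤s z≤n) ℕₚ.≤-refl

    v-absent : ∀ xs → All (_< v) xs → occursᵇ v xs ≡ false
    v-absent []       []           = refl
    v-absent (x ∷ xs) (x<v ∷ xs<v) rewrite ≡ᵇ-false {v} {x} (ℕₚ.<⇒≢ x<v ∘ sym) = v-absent xs xs<v

    ≢v-of-∈ : ∀ {x} xs → occursᵇ v xs ≡ false → x ∈ xs → x ≢ v
    ≢v-of-∈ (y ∷ ys) v∉ (here refl) x≡v = ≡ᵇ-false⇒≢ (∨-conicalˡ _ _ v∉) (sym x≡v)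
    ≢v-of-∈ (y ∷ ys) v∉ (there x∈)  x≡v = ≢v-of-∈ ys (∨-conicalʳ _ _ v∉) x∈ x≡v

    letters<v : ∀ {u} → IsRPermutation n u → All (_< v) u
    letters<v (_ , letters , _) = All.map <v letters

  insertBlock-IsRPermutation : ∀ {u g} → IsRPermutation n u → g ≤ L → IsRPermutation v (insertBlock u g)
  insertBlock-IsRPermutation {u} {g} u-perm@(len , letters , mult , avoid) g≤L =
    trans (length-insertBlock u g) (cong (r +_) len) ,
    Allₚ.++⁺ (Allₚ.take⁺ g letters′) (Allₚ.++⁺ (Allₚ.replicate⁺ r v∈values) (Allₚ.drop⁺ g letters′)) ,
    all-true⁺ _ (values v) mult′ ,
    trans (avoids-insertBlock (take g u) (drop g u) (Allₚ.take⁺ g u<v))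
          (cong₂ _∧_ avoid-u (avoids-block (drop g u) (v-absent (drop g u) (Allₚ.drop⁺ g u<v))
                                           (∧-conicalˡ _ _ (trans (sym (avoids-suffix (take g u) (drop g u))) avoid-u))))
    where
    u<v = letters<v u-perm
    letters′ = All.map ∈-values-suc letters
    avoid-u : avoids (take g u ++ drop g u) ≡ true
    avoid-u = trans (cong avoids (Listₚ.take++drop≡id g u)) avoid
    mult′ : ∀ {a} → a ∈ values v → (occurrences a (insertBlock u g) ≡ᵇ r) ≡ true
    mult′ {a} a∈ with a ℕ.≟ v
    ... | yes refl = subst (λ c → (c ≡ᵇ r) ≡ true) (sym #v) (≡ᵇ-refl r)
      where
      #v : occurrences v (insertBlock u g) ≡ r
      #v = trans (occurrences-insertBlock v u g)
             (trans (cong₂ _+_ (occurrences-replicate-self v r) (occurrences-absent v u (v-absent u u<v))) (ℕₚ.+-identityʳ r))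
    ... | no a≢v rewrite occurrences-insertBlock a u g | occurrences-block-other a a≢v =
          all-true⁻ _ (values n) mult
            (∈-values⁺ (proj₁ (∈-values⁻ a∈)) (ℕₚ.≤-pred (ℕₚ.≤∧≢⇒< (proj₂ (∈-values⁻ a∈)) a≢v)))

  IsRPermutation-insertBlock : ∀ {w} → IsRPermutation v w →
    Σ (List ℕ) λ u → Σ ℕ λ g → IsRPermutation n u × g ≤ L × w ≡ insertBlock u g
  IsRPermutation-insertBlock {w} (len , letters , mult , avoid)
    with split-at-block w avoid (All.map (proj₂ ∘ ∈-values⁻) letters) (≡ᵇ-true⇒≡ (all-true⁻ _ (values v) mult v∈values))
  ... | as , bs , w≡ , v∉as , v∉bs = u , length as , (len′ , letters′ , mult′ , avoid′) , g≤L , w≡insert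
    where
    u = as ++ bs
    w≡insert : w ≡ insertBlock u (length as)
    w≡insert = trans w≡ (sym (cong₂ (λ x y → x ++ block ++ y) (take-length-++ as bs) (drop-length-++ as bs)))
    len′ : length u ≡ n * r
    len′ = ℕₚ.+-cancelˡ-≡ r _ _ (trans (sym (length-insertBlock u (length as))) (trans (cong length (sym w≡insert)) len))
    ∈w : ∀ {x} → x ∈ u → x ∈ w × x ≢ v
    ∈w {x} x∈ with ∈ₚ.∈-++⁻ as x∈
    ... | inj₁ x∈as = subst (x ∈_) (sym w≡) (∈ₚ.∈-++⁺ˡ x∈as) , ≢v-of-∈ as v∉as x∈as
    ... | inj₂ x∈bs = subst (x ∈_) (sym w≡) (∈ₚ.∈-++⁺ʳ as (∈ₚ.∈-++⁺ʳ block x∈bs)) , ≢v-of-∈ bs v∉bs x∈bs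
    u<v : ∀ {x} → x ∈ u → x < v
    u<v x∈ = ℕₚ.≤∧≢⇒< (proj₂ (∈-values⁻ (All.lookup letters (proj₁ (∈w x∈))))) (proj₂ (∈w x∈))
    letters′ : All (_∈ values n) u
    letters′ = All.tabulate (λ x∈ → ∈-values⁺ (proj₁ (∈-values⁻ (All.lookup letters (proj₁ (∈w x∈))))) (ℕₚ.≤-pred (u<v x∈)))
    mult′ : hasMultiplicitiesₗ n u ≡ true
    mult′ = all-true⁺ _ (values n) λ {a} a∈ →
      subst (λ c → (c ≡ᵇ r) ≡ true)
            (trans (cong (occurrences a) w≡insert)
                   (trans (occurrences-insertBlock a u (length as))
                          (cong (_+ occurrences a u) (occurrences-block-other a (ℕₚ.<⇒≢ (<v a∈))))))
            (all-true⁻ _ (values v) mult (∈-values-suc a∈))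
    avoid′ : avoids u ≡ true
    avoid′ = ∧-conicalˡ _ _ (trans (sym (avoids-insertBlock as bs (All.tabulate (u<v ∘ ∈ₚ.∈-++⁺ˡ)))) (trans (cong avoids (sym w≡)) avoid))
    g≤L : length as ≤ L
    g≤L = subst (length as ≤_) len′ (subst (length as ≤_) (sym (Listₚ.length-++ as)) (ℕₚ.m≤m+n (length as) (length bs)))

  private
    gap≤length : ∀ {u g} → IsRPermutation n u → g ∈ gaps → g ≤ length u
    gap≤length (len , _) g∈ = subst (_ ≤_) (sym len) (ℕₚ.≤-pred (∈ₚ.∈-upTo⁻ g∈))

    injective : ∀ {u u′ g g′} → u ∈ 𝒬 n → u′ ∈ 𝒬 n → g ∈ gaps → g′ ∈ gaps →
                insertBlock u g ≡ insertBlock u′ g′ → u ≡ u′ × g ≡ g′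
    injective {u} {u′} u∈ u′∈ g∈ g′∈ =
      insertBlock-injective (v-absent u (letters<v (∈-𝒬⁻ u∈))) (v-absent u′ (letters<v (∈-𝒬⁻ u′∈)))
                            (gap≤length (∈-𝒬⁻ u∈) g∈) (gap≤length (∈-𝒬⁻ u′∈) g′∈)

  insertions : List (List ℕ)
  insertions = concatMap (λ u → List.map (insertBlock u) gaps) (𝒬 n)

  insertions↭𝒬 : insertions ↭ 𝒬 v
  insertions↭𝒬 = unique-↭ insertions-unique (𝒬-unique v) sound complete
    where
    insertions-unique : Unique insertions
    insertions-unique = concatMap⁺-disjointFibres (𝒬-unique n)
      (λ u∈ → map⁺-injectiveOn (Uniqueₚ.upTo⁺ (suc L)) (λ g∈ g′∈ eq → proj₂ (injective u∈ u∈ g∈ g′∈ eq)))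
      same-fibre
      where
      same-fibre : ∀ {u u′ w} → u ∈ 𝒬 n → u′ ∈ 𝒬 n →
                   w ∈ List.map (insertBlock u) gaps → w ∈ List.map (insertBlock u′) gaps → u ≡ u′
      same-fibre {u} {u′} u∈ u′∈ w∈ w∈′ with ∈ₚ.∈-map⁻ (insertBlock u) w∈ | ∈ₚ.∈-map⁻ (insertBlock u′) w∈′
      ... | g , g∈ , refl | g′ , g′∈ , eq = proj₁ (injective u∈ u′∈ g∈ g′∈ eq)
    sound : ∀ {w} → w ∈ insertions → w ∈ 𝒬 v
    sound w∈ with find (∈ₚ.∈-concatMap⁻ (λ u → List.map (insertBlock u) gaps) {xs = 𝒬 n} w∈)
    ... | u , u∈ , w∈map with ∈ₚ.∈-map⁻ (insertBlock u) w∈map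
    ... | g , g∈ , refl = ∈-𝒬⁺ (insertBlock-IsRPermutation (∈-𝒬⁻ u∈) (ℕₚ.≤-pred (∈ₚ.∈-upTo⁻ g∈)))
    complete : ∀ {w} → w ∈ 𝒬 v → w ∈ insertions
    complete w∈ with IsRPermutation-insertBlock (∈-𝒬⁻ w∈)
    ... | u , g , u-perm , g≤L , refl = ∈ₚ.∈-concatMap⁺ (λ u → List.map (insertBlock u) gaps)
          (Any.map (λ { refl → ∈ₚ.∈-map⁺ (insertBlock u) (∈ₚ.∈-upTo⁺ (s≤s g≤L)) }) (∈-𝒬⁺ u-perm))

  gapsWithDescents : List ℕ → ℕ → ℕ
  gapsWithDescents u k = countBelow (λ g → des (insertBlock u g) ≡ᵇ k) (suc L)

  coeffA-suc : ∀ k → coeffA r v k ≡ sumBy (λ u → gapsWithDescents u k) (𝒬 n)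
  coeffA-suc k = begin
    coeffA r v k                          ≡⟨ coeffA≡count v k ⟩
    count des≡k (𝒬 v)                     ≡⟨ count-↭ des≡k insertions↭𝒬 ⟨
    count des≡k insertions                ≡⟨ count-concatMap des≡k (λ u → List.map (insertBlock u) gaps) (𝒬 n) ⟩
    sumBy (λ u → count des≡k (List.map (insertBlock u) gaps)) (𝒬 n)
      ≡⟨ sumBy-cong (𝒬 n) (λ {u} _ → trans (count-map des≡k (insertBlock u) gaps) (count-applyUpTo (des≡k ∘ insertBlock u) id (suc L))) ⟩
    sumBy (λ u → gapsWithDescents u k) (𝒬 n) ∎
    where
    open ≡-Reasoning
    des≡k : List ℕ → Bool
    des≡k u = des u ≡ᵇ k

  coeffA-suc-zero : coeffA r v 0 ≡ 0
  coeffA-suc-zero = trans (coeffA-suc 0) (trans (sumBy-cong (𝒬 n) (λ {u} _ → countBelow-none (suc L) (des-insertBlock-≢0 u))) (sumBy-zero (𝒬 n)))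
    where
    des-∷-≢0 : ∀ x xs → (des (x ∷ xs) ≡ᵇ 0) ≡ false
    des-∷-≢0 x []       = refl
    des-∷-≢0 x (y ∷ ys) with y ℕ.<ᵇ x
    ... | true  = refl
    ... | false = des-∷-≢0 y ys
    des-insertBlock-≢0 : ∀ u g → (des (insertBlock u g) ≡ᵇ 0) ≡ false
    des-insertBlock-≢0 u g with take g u
    ... | []     = des-∷-≢0 v (replicate s v ++ drop g u)
    ... | x ∷ xs = des-∷-≢0 x (xs ++ block ++ drop g u)

  private
    hasDescents : ℕ → List ℕ → ℕ
    hasDescents k u = indicator (des u ≡ᵇ k)

    coeffA≡sumBy : ∀ m k → coeffA r m k ≡ sumBy (hasDescents k) (𝒬 m)
    coeffA≡sumBy m k = trans (coeffA≡count m k) (count≡sumBy _ (𝒬 m))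

    gapsWithDescents-suc : ∀ j u → u ∈ 𝒬 n →
      gapsWithDescents u (suc j) + j * hasDescents j u ≡ suc j * hasDescents (suc j) u + (L * hasDescents j u + hasDescents j u)
    gapsWithDescents-suc j u u∈ =
      trans (cong (_+ j * hasDescents j u) (countBelow-cong (suc L) (λ g → cong (_≡ᵇ suc j) (des-insertBlock u g (letters<v u-perm)))))
            (gap-count (des u) L (descentGap u) #descentGaps j)
      where
      u-perm = ∈-𝒬⁻ u∈
      #descentGaps : countBelow (descentGap u) (suc L) ≡ des u
      #descentGaps = subst (λ l → countBelow (descentGap u) (suc l) ≡ des u) (proj₁ u-perm) (countBelow-descentGap u)

  coeffA-suc-suc : ∀ j → coeffA r v (suc j) + j * coeffA r n j ≡
                         suc j * coeffA r n (suc j) + r * (n * coeffA r n j) + coeffA r n j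
  coeffA-suc-suc j = begin
    coeffA r v (suc j) + j * coeffA r n j
      ≡⟨ cong₂ _+_ (coeffA-suc (suc j)) (cong (j *_) (coeffA≡sumBy n j)) ⟩
    sumBy (λ u → gapsWithDescents u (suc j)) 𝒬ₙ + j * sumBy (hasDescents j) 𝒬ₙ
      ≡⟨ cong (sumBy (λ u → gapsWithDescents u (suc j)) 𝒬ₙ +_) (sumBy-* j (hasDescents j) 𝒬ₙ) ⟨
    sumBy (λ u → gapsWithDescents u (suc j)) 𝒬ₙ + sumBy (λ u → j * hasDescents j u) 𝒬ₙ
      ≡⟨ sumBy-+ _ _ 𝒬ₙ ⟨
    sumBy (λ u → gapsWithDescents u (suc j) + j * hasDescents j u) 𝒬ₙ
      ≡⟨ sumBy-cong 𝒬ₙ (λ {u} u∈ → gapsWithDescents-suc j u u∈) ⟩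
    sumBy (λ u → suc j * hasDescents (suc j) u + (L * hasDescents j u + hasDescents j u)) 𝒬ₙ
      ≡⟨ trans (sumBy-+ _ _ 𝒬ₙ) (cong₂ _+_ (sumBy-* (suc j) (hasDescents (suc j)) 𝒬ₙ)
                                          (trans (sumBy-+ _ _ 𝒬ₙ) (cong (_+ sumBy (hasDescents j) 𝒬ₙ) (sumBy-* L (hasDescents j) 𝒬ₙ)))) ⟩
    suc j * sumBy (hasDescents (suc j)) 𝒬ₙ + (L * sumBy (hasDescents j) 𝒬ₙ + sumBy (hasDescents j) 𝒬ₙ)
      ≡⟨ solve 4 (λ a b n r → a :+ (n :* r :* b :+ b) := a :+ r :* (n :* b) :+ b) refl
               (suc j * sumBy (hasDescents (suc j)) 𝒬ₙ) (sumBy (hasDescents j) 𝒬ₙ) n r ⟩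
    suc j * sumBy (hasDescents (suc j)) 𝒬ₙ + r * (n * sumBy (hasDescents j) 𝒬ₙ) + sumBy (hasDescents j) 𝒬ₙ
      ≡⟨ cong₂ (λ x y → suc j * x + r * (n * y) + y) (coeffA≡sumBy n (suc j)) (coeffA≡sumBy n j) ⟨
    suc j * coeffA r n (suc j) + r * (n * coeffA r n j) + coeffA r n j ∎
    where
    open ≡-Reasoning
    open import Data.Nat.Solver using (module +-*-Solver)
    open +-*-Solver
    𝒬ₙ = 𝒬 n

open import Defs
open import Data.Nat using (ℕ; _≤_; suc; s≤s; z≤n)
open import Relation.Binary.PropositionalEquality using (_≡_; refl; module ≡-Reasoning)

coeffA-recurrence : ∀ s → Eulerian.Recurrence s (coeffA (suc s))
coeffA-recurrence s = record
  { a-0-0     = refl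
  ; a-0-suc   = λ _ → refl
  ; a-suc-0   = λ n → CountingInsertions.coeffA-suc-zero s n
  ; a-suc-suc = λ n → CountingInsertions.coeffA-suc-suc s n
  }

mainTheorem1 : (r : ℕ) → 1 ≤ r → (n k : ℕ) →
    ∂z (A r) n k ≡ (((A r ^S r) ⊛ (A r ⊖ oneS)) ⊕ tS (A r ^S r)) n k
mainTheorem1 (suc s) (s≤s z≤n) n k = begin
  ∂z (A r) n k   ≡⟨ DefsNotation.∂z≡D (A r) n k ⟩
  D (A r) n k    ≡⟨ ∂X≈G n k ⟩
  G (A r) n k    ≡⟨ DefsNotation.G≡ s (A r) n k ⟩
  (((A r ^S r) ⊛ (A r ⊖ oneS)) ⊕ tS (A r ^S r)) n k ∎
  where
  open ≡-Reasoning
  r = suc s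
  open ExponentialGeneratingFunction s (coeffA r) (coeffA-recurrence s)
  open BivariateSeries using (D)
  open BivariateSeries.Equation s using (G)
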